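{- Let $G=S_q$ act on an alphabet of $q$ letters, and let $\ell$ be a positive integer with $\ell<(q+2)/2$. Let $p_1=a_1a_2\cdots a_\ell$ be the pattern consisting of $\ell$ pairwise distinct letters. Then for every pattern $p_2\neq p_1$ of length $\ell$, when letters are drawn independently and uniformly at random until the drawn sequence first ends with a word of the orbit $p_1$ or of the orbit $p_2$, the probability that a word of $p_2$ appears first is strictly smaller than the probability that a word of $p_1$ appears first.
   Context: The symmetric group $S_q$ acts on a $q$-letter alphabet $\mathcal{A}$ by permuting letters, and on words letterwise. A pattern is an $S_q$-orbit of words, written by its lexicographically least representative (e.g. $a_1a_2\cdots a_\ell$ denotes the orbit of all words of length $\ell$ with pairwise distinct letters). -}

module Defs where

open import Data.Nat using (ℕ; zero; suc; _+_)
open import Data.Bool using (Bool; true; false; if_then_else_)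
open import Data.Fin using (Fin)
open import Data.Fin.Permutation using (Permutation′; _⟨$⟩ʳ_)
open import Data.Vec using (Vec; []; _∷_; lookup; _∷ʳ_)
open import Data.List using (List; []; _∷_; map; concatMap; allFin)
open import Data.Nat.ListAction using (sum)
open import Data.Maybe using (Maybe; just; nothing)
import Data.Maybe as Maybe
open import Data.Product using (Σ)
open import Relation.Binary.PropositionalEquality using (_≡_)
open import Relation.Nullary using (Dec; does)
open import Relation.Unary using (Pred; Decidable)
open import Level using (0ℓ)

Word : ℕ → ℕ → Set
Word q ℓ = Vec (Fin q) ℓ

InOrbit : ∀ {q ℓ} → Word q ℓ → Word q ℓ → Set
InOrbit {q} w v = Σ (Permutation′ q) (λ σ → ∀ i → lookup v i ≡ (σ ⟨$⟩ʳ lookup w i))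

-- The pattern a₁a₂⋯aℓ: words of length ℓ with pairwise distinct letters.
Distinct : ∀ {q ℓ} → Word q ℓ → Set
Distinct v = ∀ i j → lookup v i ≡ lookup v j → i ≡ j

-- Last ℓ letters (chronological order) of a history stored most-recent-first.
window : ∀ {A : Set} (ℓ : ℕ) → List A → Maybe (Vec A ℓ)
window zero _ = just []
window (suc ℓ) [] = nothing
window (suc ℓ) (x ∷ xs) = Maybe.map (λ v → v ∷ʳ x) (window ℓ xs)

hits : ∀ {q} ℓ → (Word q ℓ → Bool) → List (Fin q) → Bool
hits ℓ t h with window ℓ h
... | just v = t v
... | nothing = false

data Outcome : Set where
  first second undecided : Outcome

-- Run the race: hist = letters drawn so far (most recent first),
-- rest = letters still to be drawn.  t₁, t₂ test membership in the two patterns.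
race : ∀ {q} ℓ → (Word q ℓ → Bool) → (Word q ℓ → Bool)
       → List (Fin q) → List (Fin q) → Outcome
race ℓ t₁ t₂ hist [] = undecided
race ℓ t₁ t₂ hist (x ∷ rest) =
  if hits ℓ t₁ (x ∷ hist) then first
  else if hits ℓ t₂ (x ∷ hist) then second
  else race ℓ t₁ t₂ (x ∷ hist) rest

vecToList : ∀ {A : Set} {n} → Vec A n → List A
vecToList [] = []
vecToList (x ∷ xs) = x ∷ vecToList xs

allWords : ∀ q n → List (Word q n)
allWords q zero = [] ∷ []
allWords q (suc n) = concatMap (λ x → map (x ∷_) (allWords q n)) (allFin q)

isFirst isSecond : Outcome → Bool
isFirst first = true
isFirst _ = false
isSecond second = true
isSecond _ = false

countOutcome : ∀ {q} ℓ → (Word q ℓ → Bool) → (Word q ℓ → Bool)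
               → (Outcome → Bool) → ℕ → ℕ
countOutcome {q} ℓ t₁ t₂ o n =
  sum (map (λ u → if o (race ℓ t₁ t₂ [] (vecToList u)) then 1 else 0) (allWords q n))

test : ∀ {A : Set} {P : Pred A 0ℓ} → Decidable P → A → Bool
test d a = does (d a)

-- Conway's martingale argument, applied to both patterns at once. Bet on a pattern by holding, after the
-- history h, the capital G h = Σₖ [the last k letters of h match the first k letters of the pattern] · cₖ,
-- where cₖ = q^k · nₖ ⋯ n_{ℓ-1} and nₖ counts the letters extending a match of length k. Each new letter
-- then raises the expected capital by exactly c₁ for p₁ = a₁⋯aℓ (until p₁ occurs), and by at most c₁ for
-- the orbit p₂ of w. Optional stopping at the end of the race gives a · E[G₂] ≤ b · E[G₁], where
-- a = q(q-1)⋯(q-ℓ+1) and b = q(q-1)⋯(q-d+1), d being the number of distinct letters of w.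
-- If w repeats a letter, then d < ℓ; when p₂ wins, G₂ ≥ b + q^ℓ while G₁ misses its top term q^ℓ, and when
-- p₁ wins, G₂ ≥ b. For 2ℓ < q + 2 this forces P(p₂ first) < P(p₁ first), by a margin that the undecided
-- mass cannot absorb: it is O(1/n) because E[G₁] ≥ a · n · P(undecided). If w has distinct letters, p₂ can
-- only occur together with p₁, which wins ties.

{-# OPTIONS --safe #-}
module Submission where

open import Defs
open import Data.Bool using (Bool; true; false; if_then_else_; _∧_; _∨_; not)
open import Data.Bool.Properties
  using (∨-identityʳ; ∨-comm; ∨-assoc; ∨-zeroʳ; ∨-conicalˡ; ∧-identityʳ; ∧-zeroʳ; ∧-conicalˡ; ∧-conicalʳ; not-injective; not-¬)
open import Data.Empty using (⊥-elim)
open import Data.Fin using (Fin; zero; suc)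
open import Data.Fin.Permutation using (Permutation′; _⟨$⟩ʳ_; _⟨$⟩ˡ_; inverseˡ)
open import Data.Fin.Properties using (_≟_; suc-injective)
open import Data.List using (List; []; _∷_; _++_; map; concatMap; allFin; length; take; reverse)
open import Data.List.Properties using (map-cong; map-tabulate; length-tabulate; map-∘; unfold-reverse; reverse-++; reverse-map; take-all)
open import Data.Maybe using (just)
open import Data.Nat using (ℕ; zero; suc; _+_; _*_; _^_; _∸_; _≤_; _<_; z≤n; s≤s)
open import Data.Nat.Base using (>-nonZero)
open import Data.Nat.ListAction using (sum)
open import Data.Nat.Properties hiding (_≟_; suc-injective)
open import Data.Nat.Tactic.RingSolver using (solve-∀)
open import Algebra.Properties.CommutativeSemigroup +-commutativeSemigroup
  using (interchange) renaming (x∙yz≈y∙xz to x+[y+z]≡y+[x+z])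
open import Algebra.Properties.CommutativeSemigroup *-commutativeSemigroup
  using () renaming (x∙yz≈y∙xz to x*[y*z]≡y*[x*z])
open import Data.Product using (_×_; _,_; ∃-syntax)
open import Data.Sum using (inj₁; inj₂)
open import Data.Vec using (Vec; []; _∷_; lookup; _∷ʳ_)
open import Function using (_∘_; id; const)
open import Function.Bundles using (_⇔_; mk⇔)
open import Relation.Binary.PropositionalEquality
open import Relation.Nullary using (Dec; yes; no; does; ¬_)
open import Relation.Nullary.Decidable using (dec-true; does-⇔)
open import Relation.Unary using (Decidable)

-- Sums and counting

𝟙[_] : Bool → ℕ
𝟙[ b ] = if b then 1 else 0

𝟙≤1 : ∀ b → 𝟙[ b ] ≤ 1
𝟙≤1 true  = ≤-refl
𝟙≤1 false = z≤n

∑ : {A : Set} → (A → ℕ) → List A → ℕ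
∑ f xs = sum (map f xs)

syntax ∑ (λ x → e) xs = ∑[ x ∈ xs ] e

module _ {A : Set} where

  ∑-cong : ∀ {f g : A → ℕ} xs → (∀ x → f x ≡ g x) → ∑ f xs ≡ ∑ g xs
  ∑-cong xs f≗g = cong sum (map-cong f≗g xs)

  ∑-mono-≤ : ∀ {f g : A → ℕ} xs → (∀ x → f x ≤ g x) → ∑ f xs ≤ ∑ g xs
  ∑-mono-≤ []       f≤g = z≤n
  ∑-mono-≤ (x ∷ xs) f≤g = +-mono-≤ (f≤g x) (∑-mono-≤ xs f≤g)

  ∑-+ : ∀ (f g : A → ℕ) xs → ∑[ x ∈ xs ] (f x + g x) ≡ ∑ f xs + ∑ g xs
  ∑-+ f g []       = refl
  ∑-+ f g (x ∷ xs) =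
    trans (cong (f x + g x +_) (∑-+ f g xs)) (interchange (f x) (g x) (∑ f xs) (∑ g xs))

  ∑-* : ∀ c (f : A → ℕ) xs → ∑[ x ∈ xs ] (c * f x) ≡ c * ∑ f xs
  ∑-* c f []       = sym (*-zeroʳ c)
  ∑-* c f (x ∷ xs) = trans (cong (c * f x +_) (∑-* c f xs)) (sym (*-distribˡ-+ c (f x) (∑ f xs)))

  ∑-linear : ∀ c d (f g : A → ℕ) xs →
             ∑[ x ∈ xs ] (c * f x + d * g x) ≡ c * ∑ f xs + d * ∑ g xs
  ∑-linear c d f g xs = trans (∑-+ _ _ xs) (cong₂ _+_ (∑-* c f xs) (∑-* d g xs))

  ∑-const : ∀ c (xs : List A) → ∑[ x ∈ xs ] c ≡ length xs * c
  ∑-const c []       = refl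
  ∑-const c (x ∷ xs) = cong (c +_) (∑-const c xs)

  ∑-++ : ∀ (f : A → ℕ) xs ys → ∑ f (xs ++ ys) ≡ ∑ f xs + ∑ f ys
  ∑-++ f []       ys = refl
  ∑-++ f (x ∷ xs) ys = trans (cong (f x +_) (∑-++ f xs ys)) (sym (+-assoc (f x) _ _))

∑-concatMap : ∀ {A B : Set} (f : B → ℕ) (g : A → List B) xs →
              ∑ f (concatMap g xs) ≡ ∑[ x ∈ xs ] ∑ f (g x)
∑-concatMap f g []       = refl
∑-concatMap f g (x ∷ xs) = trans (∑-++ f (g x) _) (cong (∑ f (g x) +_) (∑-concatMap f g xs))

∑-allFin-suc : ∀ {q} (f : Fin (suc q) → ℕ) → ∑ f (allFin (suc q)) ≡ f zero + ∑ (f ∘ suc) (allFin q)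
∑-allFin-suc f =
  cong (f zero +_) (cong sum (trans (map-tabulate suc f) (sym (map-tabulate id (f ∘ suc)))))

∑-allFin-const : ∀ q c → ∑[ x ∈ allFin q ] c ≡ q * c
∑-allFin-const q c = trans (∑-const c (allFin q)) (cong (_* c) (length-tabulate {n = q} (id {A = Fin q})))

∑-allWords-suc : ∀ q n (f : Word q (suc n) → ℕ) →
                 ∑ f (allWords q (suc n)) ≡ ∑[ x ∈ allFin q ] ∑[ u ∈ allWords q n ] f (x ∷ u)
∑-allWords-suc q n f =
  trans (∑-concatMap f _ (allFin q)) (∑-cong (allFin q) λ x → cong sum (sym (map-∘ (allWords q n))))

∑-allWords-const : ∀ q n c → ∑[ u ∈ allWords q n ] c ≡ q ^ n * c
∑-allWords-const q zero    c = trans (+-identityʳ c) (sym (*-identityˡ c))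
∑-allWords-const q (suc n) c = begin
  ∑[ u ∈ allWords q (suc n) ] c              ≡⟨ ∑-allWords-suc q n (const c) ⟩
  ∑[ x ∈ allFin q ] ∑[ u ∈ allWords q n ] c  ≡⟨ ∑-cong (allFin q) (λ _ → ∑-allWords-const q n c) ⟩
  ∑[ x ∈ allFin q ] (q ^ n * c)              ≡⟨ ∑-allFin-const q (q ^ n * c) ⟩
  q * (q ^ n * c)                            ≡⟨ sym (*-assoc q (q ^ n) c) ⟩
  q ^ suc n * c                              ∎
  where open ≡-Reasoning

count : ∀ q → (Fin q → Bool) → ℕ
count q p = ∑[ x ∈ allFin q ] 𝟙[ p x ]

count-suc : ∀ {q} (p : Fin (suc q) → Bool) → count (suc q) p ≡ 𝟙[ p zero ] + count q (p ∘ suc)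
count-suc p = ∑-allFin-suc (λ x → 𝟙[ p x ])

count-false : ∀ q → count q (const false) ≡ 0
count-false q = trans (∑-allFin-const q 0) (*-zeroʳ q)

count-mono : ∀ q {p r : Fin q → Bool} → (∀ x → p x ≡ true → r x ≡ true) → count q p ≤ count q r
count-mono q {p} {r} p⇒r = ∑-mono-≤ (allFin q) 𝟙-mono
  where
  𝟙-mono : ∀ x → 𝟙[ p x ] ≤ 𝟙[ r x ]
  𝟙-mono x with p x | p⇒r x
  ... | true  | r≡true = ≤-reflexive (cong 𝟙[_] (sym (r≡true refl)))
  ... | false | _      = z≤n

count-not : ∀ q (p : Fin q → Bool) → count q (not ∘ p) + count q p ≡ q
count-not q p = begin
  count q (not ∘ p) + count q p          ≡⟨ sym (∑-+ _ _ (allFin q)) ⟩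
  ∑[ x ∈ allFin q ] (𝟙[ not (p x) ] + 𝟙[ p x ]) ≡⟨ ∑-cong (allFin q) (λ x → 𝟙-not (p x)) ⟩
  ∑[ x ∈ allFin q ] 1                    ≡⟨ ∑-allFin-const q 1 ⟩
  q * 1                                  ≡⟨ *-identityʳ q ⟩
  q                                      ∎
  where
  open ≡-Reasoning
  𝟙-not : ∀ b → 𝟙[ not b ] + 𝟙[ b ] ≡ 1
  𝟙-not true  = refl
  𝟙-not false = refl

count-insert : ∀ {q} (a : Fin q) (p : Fin q → Bool) →
               count q (λ x → does (x ≟ a) ∨ p x) ≡ 𝟙[ not (p a) ] + count q p
count-insert {suc q} zero p = begin
  count (suc q) (λ x → does (x ≟ zero) ∨ p x)            ≡⟨ count-suc (λ x → does (x ≟ zero) ∨ p x) ⟩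
  1 + count q (p ∘ suc)                                   ≡⟨ insert (p zero) ⟩
  𝟙[ not (p zero) ] + (𝟙[ p zero ] + count q (p ∘ suc))   ≡⟨ cong (𝟙[ not (p zero) ] +_) (sym (count-suc p)) ⟩
  𝟙[ not (p zero) ] + count (suc q) p                     ∎
  where
  open ≡-Reasoning
  insert : ∀ b → 1 + count q (p ∘ suc) ≡ 𝟙[ not b ] + (𝟙[ b ] + count q (p ∘ suc))
  insert true  = refl
  insert false = refl
count-insert {suc q} (suc a) p = begin
  count (suc q) (λ x → does (x ≟ suc a) ∨ p x)              ≡⟨ count-suc (λ x → does (x ≟ suc a) ∨ p x) ⟩
  𝟙[ p zero ] + count q (λ x → does (x ≟ a) ∨ p (suc x))    ≡⟨ cong (𝟙[ p zero ] +_) (count-insert a (p ∘ suc)) ⟩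
  𝟙[ p zero ] + (𝟙[ not (p (suc a)) ] + count q (p ∘ suc))
    ≡⟨ x+[y+z]≡y+[x+z] 𝟙[ p zero ] 𝟙[ not (p (suc a)) ] (count q (p ∘ suc)) ⟩
  𝟙[ not (p (suc a)) ] + (𝟙[ p zero ] + count q (p ∘ suc))  ≡⟨ cong (𝟙[ not (p (suc a)) ] +_) (sym (count-suc p)) ⟩
  𝟙[ not (p (suc a)) ] + count (suc q) p                    ∎
  where open ≡-Reasoning

count-≤1 : ∀ q (p : Fin q → Bool) → (∀ x y → p x ≡ true → p y ≡ true → x ≡ y) → count q p ≤ 1
count-≤1 zero    p unique = z≤n
count-≤1 (suc q) p unique = ≤-trans (≤-reflexive (count-suc p)) (split (p zero) refl)
  where
  split : ∀ b → p zero ≡ b → 𝟙[ b ] + count q (p ∘ suc) ≤ 1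
  split true  p0 = ≤-reflexive (cong suc (trans (∑-cong (allFin q) none-else) (count-false q)))
    where
    none-else : ∀ x → 𝟙[ p (suc x) ] ≡ 0
    none-else x with p (suc x) in px
    ... | true  with () ← unique zero (suc x) p0 px
    ... | false = refl
  split false _  = count-≤1 q (p ∘ suc) (λ x y px py → suc-injective (unique _ _ px py))

∑< : ℕ → (ℕ → ℕ) → ℕ
∑< zero    f = 0
∑< (suc k) f = f 0 + ∑< k (f ∘ suc)

syntax ∑< k (λ j → e) = ∑[ j < k ] e

∑<-snoc : ∀ k f → ∑< (suc k) f ≡ ∑< k f + f k
∑<-snoc zero    f = +-comm (f 0) 0
∑<-snoc (suc k) f = trans (cong (f 0 +_) (∑<-snoc k (f ∘ suc))) (sym (+-assoc (f 0) _ _))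

∑<-cong : ∀ k {f g : ℕ → ℕ} → (∀ j → j < k → f j ≡ g j) → ∑< k f ≡ ∑< k g
∑<-cong zero    f≗g = refl
∑<-cong (suc k) f≗g = cong₂ _+_ (f≗g 0 (s≤s z≤n)) (∑<-cong k (λ j j<k → f≗g (suc j) (s≤s j<k)))

∑<-mono-≤ : ∀ k {f g : ℕ → ℕ} → (∀ j → j < k → f j ≤ g j) → ∑< k f ≤ ∑< k g
∑<-mono-≤ zero    f≤g = z≤n
∑<-mono-≤ (suc k) f≤g = +-mono-≤ (f≤g 0 (s≤s z≤n)) (∑<-mono-≤ k (λ j j<k → f≤g (suc j) (s≤s j<k)))

∑<-* : ∀ k c f → ∑[ j < k ] (c * f j) ≡ c * ∑< k f
∑<-* zero    c f = sym (*-zeroʳ c)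
∑<-* (suc k) c f = trans (cong (c * f 0 +_) (∑<-* k c (f ∘ suc))) (sym (*-distribˡ-+ c _ _))

∑<-const : ∀ k c → ∑[ j < k ] c ≡ k * c
∑<-const zero    c = refl
∑<-const (suc k) c = cong (c +_) (∑<-const k c)

∑-∑<-comm : ∀ {A : Set} (xs : List A) k (f : A → ℕ → ℕ) →
            ∑[ x ∈ xs ] ∑< k (f x) ≡ ∑[ j < k ] ∑[ x ∈ xs ] f x j
∑-∑<-comm xs zero    f = trans (∑-const 0 xs) (*-zeroʳ (length xs))
∑-∑<-comm xs (suc k) f =
  trans (∑-+ (λ x → f x 0) (λ x → ∑< k (f x ∘ suc)) xs)
        (cong (∑ (λ x → f x 0) xs +_) (∑-∑<-comm xs k (λ x → f x ∘ suc)))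

∏from : (ℕ → ℕ) → ℕ → ℕ → ℕ
∏from f s zero    = 1
∏from f s (suc j) = f s * ∏from f (suc s) j

∏from-snoc : ∀ f s j → ∏from f s (suc j) ≡ ∏from f s j * f (s + j)
∏from-snoc f s zero    = trans (*-identityʳ (f s)) (trans (cong f (sym (+-identityʳ s))) (sym (*-identityˡ _)))
∏from-snoc f s (suc j) = begin
  f s * (f (suc s) * ∏from f (suc (suc s)) j)  ≡⟨ cong (f s *_) (∏from-snoc f (suc s) j) ⟩
  f s * (∏from f (suc s) j * f (suc s + j))    ≡⟨ sym (*-assoc (f s) _ _) ⟩
  f s * ∏from f (suc s) j * f (suc s + j)      ≡⟨ cong (λ i → f s * ∏from f (suc s) j * f i) (sym (+-suc s j)) ⟩
  f s * ∏from f (suc s) j * f (s + suc j)      ∎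
  where open ≡-Reasoning

infixl 8 _↓_

_↓_ : ℕ → ℕ → ℕ
q ↓ k = ∏from (q ∸_) 0 k

↓-suc : ∀ q k → q ↓ suc k ≡ q ↓ k * (q ∸ k)
↓-suc q k = ∏from-snoc (q ∸_) 0 k

↓-≤-suc : ∀ {q k} → k < q → q ↓ k ≤ q ↓ suc k
↓-≤-suc {q} {k} k<q = begin
  q ↓ k              ≡⟨ sym (*-identityʳ (q ↓ k)) ⟩
  q ↓ k * 1          ≤⟨ *-monoʳ-≤ (q ↓ k) (m<n⇒0<n∸m k<q) ⟩
  q ↓ k * (q ∸ k)    ≡⟨ sym (↓-suc q k) ⟩
  q ↓ suc k          ∎
  where open ≤-Reasoning

↓-positive : ∀ {q k} → k ≤ q → 1 ≤ q ↓ k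
↓-positive {k = zero}  _   = ≤-refl
↓-positive {k = suc k} k<q = ≤-trans (↓-positive (<⇒≤ k<q)) (↓-≤-suc k<q)

↓-mono-≤ : ∀ {q j k} → j ≤ k → k ≤ q → q ↓ j ≤ q ↓ k
↓-mono-≤ {k = zero}  z≤n _ = ≤-refl
↓-mono-≤ {k = suc k} j≤k k<q with m≤n⇒m<n∨m≡n j≤k
... | inj₁ (s≤s j≤k′) = ≤-trans (↓-mono-≤ j≤k′ (<⇒≤ k<q)) (↓-≤-suc k<q)
... | inj₂ refl       = ≤-refl

↓-choices : ∀ q d b → q ↓ d * (if b then 1 else q ∸ d) ≡ q ↓ (𝟙[ not b ] + d)
↓-choices q d true  = *-identityʳ (q ↓ d)
↓-choices q d false = sym (↓-suc q d)

∏from-∸ : ∀ q k r → ∏from (q ∸_) k (suc r) ≤ q ^ r * (q ∸ (k + r))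
∏from-∸ q k zero    =
  ≤-reflexive (trans (*-identityʳ (q ∸ k)) (trans (cong (q ∸_) (sym (+-identityʳ k))) (sym (*-identityˡ _))))
∏from-∸ q k (suc r) = begin
  (q ∸ k) * ∏from (q ∸_) (suc k) (suc r)  ≤⟨ *-mono-≤ (m∸n≤m q k) (∏from-∸ q (suc k) r) ⟩
  q * (q ^ r * (q ∸ (suc k + r)))         ≡⟨ sym (*-assoc q (q ^ r) _) ⟩
  q ^ suc r * (q ∸ (suc k + r))           ≡⟨ cong (λ i → q ^ suc r * (q ∸ i)) (sym (+-suc k r)) ⟩
  q ^ suc r * (q ∸ (k + suc r))           ∎
  where open ≤-Reasoning

-- Equality patterns of words

does⇒ : ∀ {P : Set} (P? : Dec P) → does P? ≡ true → P
does⇒ (yes p) _ = p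

infix 7 _∈ᵇ_

_∈ᵇ_ : ∀ {q} → Fin q → List (Fin q) → Bool
x ∈ᵇ []       = false
x ∈ᵇ (y ∷ ys) = does (x ≟ y) ∨ x ∈ᵇ ys

#distinct : ∀ {q} → List (Fin q) → ℕ
#distinct []       = 0
#distinct (x ∷ xs) = 𝟙[ not (x ∈ᵇ xs) ] + #distinct xs

uniqueᵇ : ∀ {q} → List (Fin q) → Bool
uniqueᵇ []       = true
uniqueᵇ (x ∷ xs) = not (x ∈ᵇ xs) ∧ uniqueᵇ xs

count-∈ᵇ : ∀ q (xs : List (Fin q)) → count q (_∈ᵇ xs) ≡ #distinct xs
count-∈ᵇ q []       = count-false q
count-∈ᵇ q (y ∷ ys) =
  trans (count-insert y (_∈ᵇ ys)) (cong (𝟙[ not (y ∈ᵇ ys) ] +_) (count-∈ᵇ q ys))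

count-∉ᵇ : ∀ q (xs : List (Fin q)) → count q (not ∘ (_∈ᵇ xs)) ≡ q ∸ #distinct xs
count-∉ᵇ q xs = begin
  count q (not ∘ (_∈ᵇ xs))                                          ≡⟨ sym (m+n∸n≡m _ (count q (_∈ᵇ xs))) ⟩
  count q (not ∘ (_∈ᵇ xs)) + count q (_∈ᵇ xs) ∸ count q (_∈ᵇ xs)
    ≡⟨ cong₂ _∸_ (count-not q (_∈ᵇ xs)) (count-∈ᵇ q xs) ⟩
  q ∸ #distinct xs                                                  ∎
  where open ≡-Reasoning

module _ {q : ℕ} where

  head-fresh : ∀ {x : Fin q} xs → uniqueᵇ (x ∷ xs) ≡ true → x ∈ᵇ xs ≡ false
  head-fresh xs u = not-injective (∧-conicalˡ _ _ u)

  ∈ᵇ-++ : ∀ (x : Fin q) xs ys → x ∈ᵇ (xs ++ ys) ≡ x ∈ᵇ xs ∨ x ∈ᵇ ys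
  ∈ᵇ-++ x []       ys = refl
  ∈ᵇ-++ x (z ∷ xs) ys = trans (cong (does (x ≟ z) ∨_) (∈ᵇ-++ x xs ys)) (sym (∨-assoc (does (x ≟ z)) _ _))

  ∈ᵇ-reverse : ∀ (x : Fin q) xs → x ∈ᵇ reverse xs ≡ x ∈ᵇ xs
  ∈ᵇ-reverse x []       = refl
  ∈ᵇ-reverse x (y ∷ ys) = begin
    x ∈ᵇ reverse (y ∷ ys)                       ≡⟨ cong (x ∈ᵇ_) (unfold-reverse y ys) ⟩
    x ∈ᵇ (reverse ys ++ y ∷ [])                 ≡⟨ ∈ᵇ-++ x (reverse ys) (y ∷ []) ⟩
    x ∈ᵇ reverse ys ∨ (does (x ≟ y) ∨ false)    ≡⟨ cong₂ _∨_ (∈ᵇ-reverse x ys) (∨-identityʳ _) ⟩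
    x ∈ᵇ ys ∨ does (x ≟ y)                      ≡⟨ ∨-comm (x ∈ᵇ ys) _ ⟩
    x ∈ᵇ (y ∷ ys)                               ∎
    where open ≡-Reasoning

  #distinct-reverse : (xs : List (Fin q)) → #distinct (reverse xs) ≡ #distinct xs
  #distinct-reverse xs = begin
    #distinct (reverse xs)        ≡⟨ sym (count-∈ᵇ q (reverse xs)) ⟩
    count q (_∈ᵇ reverse xs)      ≡⟨ ∑-cong (allFin q) (λ x → cong 𝟙[_] (∈ᵇ-reverse x xs)) ⟩
    count q (_∈ᵇ xs)              ≡⟨ count-∈ᵇ q xs ⟩
    #distinct xs                  ∎
    where open ≡-Reasoning

  #distinct≤length : (xs : List (Fin q)) → #distinct xs ≤ length xs
  #distinct≤length []       = z≤n
  #distinct≤length (x ∷ xs) = +-mono-≤ (𝟙≤1 (not (x ∈ᵇ xs))) (#distinct≤length xs)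

  unique⇒#distinct≡length : (xs : List (Fin q)) → uniqueᵇ xs ≡ true → #distinct xs ≡ length xs
  unique⇒#distinct≡length []       _ = refl
  unique⇒#distinct≡length (x ∷ xs) u with x ∈ᵇ xs | u
  ... | false | u′ = cong suc (unique⇒#distinct≡length xs u′)

  ¬unique⇒#distinct<length : (xs : List (Fin q)) → uniqueᵇ xs ≡ false → #distinct xs < length xs
  ¬unique⇒#distinct<length (x ∷ xs) ¬u with x ∈ᵇ xs | ¬u
  ... | true  | _   = s≤s (#distinct≤length xs)
  ... | false | ¬u′ = s≤s (¬unique⇒#distinct<length xs ¬u′)

infix 4 _⇔ᵇ_

_⇔ᵇ_ : Bool → Bool → Bool
true  ⇔ᵇ b = b
false ⇔ᵇ b = not b

⇔ᵇ⇒≡ : ∀ {a b} → (a ⇔ᵇ b) ≡ true → a ≡ b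
⇔ᵇ⇒≡ {true}  {true}  _ = refl
⇔ᵇ⇒≡ {false} {false} _ = refl

⇔ᵇ-refl : ∀ a → (a ⇔ᵇ a) ≡ true
⇔ᵇ-refl true  = refl
⇔ᵇ-refl false = refl

agreesᵇ : ∀ {q} → Fin q → List (Fin q) → Fin q → List (Fin q) → Bool
agreesᵇ x []        y []        = true
agreesᵇ x (x′ ∷ xs) y (y′ ∷ ys) = (does (x ≟ x′) ⇔ᵇ does (y ≟ y′)) ∧ agreesᵇ x xs y ys
agreesᵇ _ _         _ _         = false

-- xs and ys have the same length and the same equality pattern: xs i ≡ xs j iff ys i ≡ ys j.
samePatternᵇ : ∀ {q} → List (Fin q) → List (Fin q) → Bool
samePatternᵇ []       []       = true
samePatternᵇ (x ∷ xs) (y ∷ ys) = agreesᵇ x xs y ys ∧ samePatternᵇ xs ys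
samePatternᵇ _        _        = false

choices : ∀ q → Fin q → List (Fin q) → ℕ
choices q y ys = if y ∈ᵇ ys then 1 else q ∸ #distinct ys

module _ {q : ℕ} where

  agrees⇒∈ᵇ≡ : ∀ {x y : Fin q} xs ys → agreesᵇ x xs y ys ≡ true → x ∈ᵇ xs ≡ y ∈ᵇ ys
  agrees⇒∈ᵇ≡ []        []        _  = refl
  agrees⇒∈ᵇ≡ (x′ ∷ xs) (y′ ∷ ys) ag =
    cong₂ _∨_ (⇔ᵇ⇒≡ (∧-conicalˡ _ _ ag)) (agrees⇒∈ᵇ≡ xs ys (∧-conicalʳ _ _ ag))

  samePattern⇒#distinct≡ : (xs ys : List (Fin q)) → samePatternᵇ xs ys ≡ true → #distinct xs ≡ #distinct ys
  samePattern⇒#distinct≡ []       []       _    = refl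
  samePattern⇒#distinct≡ (x ∷ xs) (y ∷ ys) same =
    cong₂ _+_ (cong (𝟙[_] ∘ not) (agrees⇒∈ᵇ≡ xs ys (∧-conicalˡ _ _ same)))
              (samePattern⇒#distinct≡ xs ys (∧-conicalʳ _ _ same))

  agrees-functional : ∀ {x x′ : Fin q} xs y ys → y ∈ᵇ ys ≡ true →
                      agreesᵇ x xs y ys ≡ true → agreesᵇ x′ xs y ys ≡ true → x ≡ x′
  agrees-functional (z ∷ xs) y (y′ ∷ ys) y∈ ag ag′ with does (y ≟ y′)
  ... | true  = trans (≡z ag) (sym (≡z ag′))
    where
    ≡z : ∀ {x} → (does (x ≟ z) ⇔ᵇ true) ∧ agreesᵇ x xs y ys ≡ true → x ≡ z
    ≡z {x} ag = does⇒ (x ≟ z) (⇔ᵇ⇒≡ (∧-conicalˡ _ _ ag))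
  ... | false = agrees-functional xs y ys y∈ (∧-conicalʳ _ _ ag) (∧-conicalʳ _ _ ag′)

  count-agrees : ∀ (xs : List (Fin q)) y ys → samePatternᵇ xs ys ≡ true →
                 count q (λ x → agreesᵇ x xs y ys) ≤ choices q y ys
  count-agrees xs y ys same with y ∈ᵇ ys in y∈
  ... | true  = count-≤1 q _ (λ x x′ → agrees-functional xs y ys y∈)
  ... | false = begin
    count q (λ x → agreesᵇ x xs y ys) ≤⟨ count-mono q (λ x ag → cong not (trans (agrees⇒∈ᵇ≡ xs ys ag) y∈)) ⟩
    count q (not ∘ (_∈ᵇ xs))          ≡⟨ count-∉ᵇ q xs ⟩
    q ∸ #distinct xs                  ≡⟨ cong (q ∸_) (samePattern⇒#distinct≡ xs ys same) ⟩
    q ∸ #distinct ys                  ∎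
    where open ≤-Reasoning

  count-samePattern-∷ : ∀ (xs : List (Fin q)) y ys →
    count q (λ x → samePatternᵇ (x ∷ xs) (y ∷ ys)) ≤ 𝟙[ samePatternᵇ xs ys ] * choices q y ys
  count-samePattern-∷ xs y ys with samePatternᵇ xs ys in same
  ... | true  = begin
    count q (λ x → agreesᵇ x xs y ys ∧ true) ≡⟨ ∑-cong (allFin q) (λ x → cong 𝟙[_] (∧-identityʳ _)) ⟩
    count q (λ x → agreesᵇ x xs y ys)        ≤⟨ count-agrees xs y ys same ⟩
    choices q y ys                           ≡⟨ sym (+-identityʳ _) ⟩
    1 * choices q y ys                       ∎
    where open ≤-Reasoning
  ... | false = ≤-reflexive (trans (∑-cong (allFin q) (λ x → cong 𝟙[_] (∧-zeroʳ _))) (count-false q))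

  samePattern-map : ∀ (f : Fin q → Fin q) → (∀ {a b} → f a ≡ f b → a ≡ b) →
                    (ys : List (Fin q)) → samePatternᵇ (map f ys) ys ≡ true
  samePattern-map f f-inj []       = refl
  samePattern-map f f-inj (y ∷ ys) = cong₂ _∧_ (agrees-image ys) (samePattern-map f f-inj ys)
    where
    agrees-image : ∀ zs → agreesᵇ (f y) (map f zs) y zs ≡ true
    agrees-image []       = refl
    agrees-image (z ∷ zs) = cong₂ _∧_
      (trans (cong (_⇔ᵇ does (y ≟ z)) (does-⇔ (mk⇔ f-inj (cong f)) (f y ≟ f z) (y ≟ z))) (⇔ᵇ-refl (does (y ≟ z))))
      (agrees-image zs)

-- Windows, distinct words and orbits

module _ {A : Set} where

  length-vecToList : ∀ {n} (v : Vec A n) → length (vecToList v) ≡ n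
  length-vecToList []      = refl
  length-vecToList (x ∷ v) = cong suc (length-vecToList v)

  vecToList-∷ʳ : ∀ {n} (v : Vec A n) x → vecToList (v ∷ʳ x) ≡ vecToList v ++ x ∷ []
  vecToList-∷ʳ []      x = refl
  vecToList-∷ʳ (y ∷ v) x = cong (y ∷_) (vecToList-∷ʳ v x)

  reverse-vecToList-∷ʳ : ∀ {n} (v : Vec A n) x → reverse (vecToList (v ∷ʳ x)) ≡ x ∷ reverse (vecToList v)
  reverse-vecToList-∷ʳ v x = trans (cong reverse (vecToList-∷ʳ v x)) (reverse-++ (vecToList v) (x ∷ []))

  window-defined : ∀ k (h : List A) → k ≤ length h → ∃[ v ] window k h ≡ just v
  window-defined zero    h       _         = [] , refl
  window-defined (suc k) (x ∷ h) (s≤s k≤h) with window k h | window-defined k h k≤h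
  ... | just v | _ = v ∷ʳ x , refl

  window⇒take : ∀ k (h : List A) v → window k h ≡ just v → take k h ≡ reverse (vecToList v)
  window⇒take zero    h       [] _ = refl
  window⇒take (suc k) (x ∷ h) v  w≡v with window k h in w≡v′
  window⇒take (suc k) (x ∷ h) .(v′ ∷ʳ x) refl | just v′ =
    trans (cong (x ∷_) (window⇒take k h v′ w≡v′)) (sym (reverse-vecToList-∷ʳ v′ x))

  nth : List A → ℕ → A → A
  nth []       k       d = d
  nth (x ∷ xs) zero    d = x
  nth (x ∷ xs) (suc k) d = nth xs k d

  reversedPrefix : List A → A → ℕ → List A
  reversedPrefix xs d zero    = []
  reversedPrefix xs d (suc k) = nth xs k d ∷ reversedPrefix xs d k

  take-suc-nth : ∀ (xs : List A) d k → k < length xs → take (suc k) xs ≡ take k xs ++ nth xs k d ∷ []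
  take-suc-nth (x ∷ xs) d zero    _         = refl
  take-suc-nth (x ∷ xs) d (suc k) (s≤s k<n) = cong (x ∷_) (take-suc-nth xs d k k<n)

  reversedPrefix≡reverse-take : ∀ (xs : List A) d k → k ≤ length xs → reversedPrefix xs d k ≡ reverse (take k xs)
  reversedPrefix≡reverse-take xs d zero    _   = refl
  reversedPrefix≡reverse-take xs d (suc k) k<n = begin
    nth xs k d ∷ reversedPrefix xs d k
      ≡⟨ cong (nth xs k d ∷_) (reversedPrefix≡reverse-take xs d k (≤-trans (n≤1+n k) k<n)) ⟩
    nth xs k d ∷ reverse (take k xs)           ≡⟨ sym (reverse-++ (take k xs) (nth xs k d ∷ [])) ⟩
    reverse (take k xs ++ nth xs k d ∷ [])          ≡⟨ cong reverse (sym (take-suc-nth xs d k k<n)) ⟩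
    reverse (take (suc k) xs)                  ∎
    where open ≡-Reasoning

  reversedPrefix-all : ∀ {n} (v : Vec A n) d → reversedPrefix (vecToList v) d n ≡ reverse (vecToList v)
  reversedPrefix-all {n} v d = trans (reversedPrefix≡reverse-take (vecToList v) d n n≤length)
                                     (cong reverse (take-all n (vecToList v) (≤-reflexive (length-vecToList v))))
    where
    n≤length : n ≤ length (vecToList v)
    n≤length = ≤-reflexive (sym (length-vecToList v))

hits⇒window : ∀ {q} ℓ (t : Word q ℓ → Bool) h → hits ℓ t h ≡ true → ∃[ v ] window ℓ h ≡ just v × t v ≡ true
hits⇒window ℓ t h hit with window ℓ h
... | just v = v , refl , hit

hits-window : ∀ {q} ℓ (t : Word q ℓ → Bool) h v → window ℓ h ≡ just v → hits ℓ t h ≡ t v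
hits-window ℓ t h v w≡v with window ℓ h
hits-window ℓ t h v refl | just .v = refl

module _ {q : ℕ} where

  ∈ᵇ-lookup : ∀ {n} (v : Vec (Fin q) n) j → lookup v j ∈ᵇ vecToList v ≡ true
  ∈ᵇ-lookup (x ∷ v) zero    = cong (_∨ x ∈ᵇ vecToList v) (dec-true (x ≟ x) refl)
  ∈ᵇ-lookup (x ∷ v) (suc j) = trans (cong (does (lookup v j ≟ x) ∨_) (∈ᵇ-lookup v j)) (∨-zeroʳ _)

  unique⇒Distinct : ∀ {n} (v : Vec (Fin q) n) → uniqueᵇ (vecToList v) ≡ true → Distinct v
  unique⇒Distinct (x ∷ v) u zero    zero    _  = refl
  unique⇒Distinct (x ∷ v) u zero    (suc j) eq =
    ⊥-elim (not-¬ (head-fresh (vecToList v) u) (trans (cong (_∈ᵇ vecToList v) eq) (∈ᵇ-lookup v j)))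
  unique⇒Distinct (x ∷ v) u (suc i) zero    eq =
    ⊥-elim (not-¬ (head-fresh (vecToList v) u) (trans (cong (_∈ᵇ vecToList v) (sym eq)) (∈ᵇ-lookup v i)))
  unique⇒Distinct (x ∷ v) u (suc i) (suc j) eq = cong suc (unique⇒Distinct v (∧-conicalʳ _ _ u) i j eq)

  #distinct≡length⇒Distinct : ∀ {n} (v : Vec (Fin q) n) → #distinct (vecToList v) ≡ n → Distinct v
  #distinct≡length⇒Distinct {n} v #v≡n with uniqueᵇ (vecToList v) in u
  ... | true  = unique⇒Distinct v u
  ... | false = ⊥-elim (<-irrefl (trans #v≡n (sym (length-vecToList v)))
                                 (¬unique⇒#distinct<length (vecToList v) u))

  ¬Distinct⇒#distinct<length : ∀ {n} (v : Vec (Fin q) n) → ¬ Distinct v → #distinct (vecToList v) < n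
  ¬Distinct⇒#distinct<length v ¬distinct with uniqueᵇ (vecToList v) in u
  ... | true  = ⊥-elim (¬distinct (unique⇒Distinct v u))
  ... | false = subst (#distinct (vecToList v) <_) (length-vecToList v) (¬unique⇒#distinct<length (vecToList v) u)

  Distinct-single : (v : Vec (Fin q) 1) → Distinct v
  Distinct-single v zero zero _ = refl

  ⟨$⟩ʳ-injective : (σ : Permutation′ q) → ∀ {a b} → σ ⟨$⟩ʳ a ≡ σ ⟨$⟩ʳ b → a ≡ b
  ⟨$⟩ʳ-injective σ eq = trans (sym (inverseˡ σ)) (trans (cong (σ ⟨$⟩ˡ_) eq) (inverseˡ σ))

  orbit-Distinct : ∀ {n} (w v : Vec (Fin q) n) → Distinct w → InOrbit w v → Distinct v
  orbit-Distinct w v distinct (σ , v≡σw) i j eq =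
    distinct i j (⟨$⟩ʳ-injective σ (trans (sym (v≡σw i)) (trans eq (v≡σw j))))

  orbit⇒samePattern : ∀ {n} (w v : Vec (Fin q) n) → InOrbit w v →
                      samePatternᵇ (reverse (vecToList v)) (reverse (vecToList w)) ≡ true
  orbit⇒samePattern w v (σ , v≡σw) = begin
    samePatternᵇ (reverse (vecToList v)) (reverse (vecToList w))
      ≡⟨ cong (λ xs → samePatternᵇ (reverse xs) (reverse (vecToList w))) (vecToList-orbit v w v≡σw) ⟩
    samePatternᵇ (reverse (map (σ ⟨$⟩ʳ_) (vecToList w))) (reverse (vecToList w))
      ≡⟨ cong (λ xs → samePatternᵇ xs (reverse (vecToList w))) (sym (reverse-map (σ ⟨$⟩ʳ_) (vecToList w))) ⟩
    samePatternᵇ (map (σ ⟨$⟩ʳ_) (reverse (vecToList w))) (reverse (vecToList w))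
      ≡⟨ samePattern-map (σ ⟨$⟩ʳ_) (⟨$⟩ʳ-injective σ) (reverse (vecToList w)) ⟩
    true ∎
    where
    open ≡-Reasoning
    vecToList-orbit : ∀ {n} (v w : Vec (Fin q) n) → (∀ i → lookup v i ≡ σ ⟨$⟩ʳ lookup w i) →
                      vecToList v ≡ map (σ ⟨$⟩ʳ_) (vecToList w)
    vecToList-orbit []      []      _    = refl
    vecToList-orbit (x ∷ v) (y ∷ w) v≡σw = cong₂ _∷_ (v≡σw zero) (vecToList-orbit v w (v≡σw ∘ suc))

distinctPrefixᵇ : ∀ {q} → ℕ → List (Fin q) → Bool
distinctPrefixᵇ zero    h       = true
distinctPrefixᵇ (suc k) []      = false
distinctPrefixᵇ (suc k) (x ∷ h) = not (x ∈ᵇ take k h) ∧ distinctPrefixᵇ k h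

module _ {q : ℕ} where

  distinctPrefix⇒≤length : ∀ k (h : List (Fin q)) → distinctPrefixᵇ k h ≡ true → k ≤ length h
  distinctPrefix⇒≤length zero    h       _ = z≤n
  distinctPrefix⇒≤length (suc k) (x ∷ h) d = s≤s (distinctPrefix⇒≤length k h (∧-conicalʳ _ _ d))

  distinctPrefix⇒#distinct : ∀ k (h : List (Fin q)) → distinctPrefixᵇ k h ≡ true → #distinct (take k h) ≡ k
  distinctPrefix⇒#distinct zero    h       _ = refl
  distinctPrefix⇒#distinct (suc k) (x ∷ h) d =
    cong₂ _+_ (cong 𝟙[_] (∧-conicalˡ _ _ d)) (distinctPrefix⇒#distinct k h (∧-conicalʳ _ _ d))

  count-distinctPrefix-∷ : ∀ k (h : List (Fin q)) →
                           count q (λ x → distinctPrefixᵇ (suc k) (x ∷ h)) ≡ 𝟙[ distinctPrefixᵇ k h ] * (q ∸ k)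
  count-distinctPrefix-∷ k h with distinctPrefixᵇ k h in d
  ... | true  = begin
    count q (λ x → not (x ∈ᵇ take k h) ∧ true) ≡⟨ ∑-cong (allFin q) (λ x → cong 𝟙[_] (∧-identityʳ _)) ⟩
    count q (not ∘ (_∈ᵇ take k h))             ≡⟨ count-∉ᵇ q (take k h) ⟩
    q ∸ #distinct (take k h)                   ≡⟨ cong (q ∸_) (distinctPrefix⇒#distinct k h d) ⟩
    q ∸ k                                      ≡⟨ sym (+-identityʳ _) ⟩
    1 * (q ∸ k)                                ∎
    where open ≡-Reasoning
  ... | false = trans (∑-cong (allFin q) (λ x → cong 𝟙[_] (∧-zeroʳ _))) (count-false q)

-- Conway capitals

-- m k h: the k most recent letters of h match the first k letters of the pattern;
-- n k: the number of letters x turning such a match of length k in h into one of length k + 1 in x ∷ h.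
module Capital (q L : ℕ) (n : ℕ → ℕ) (m : ℕ → List (Fin q) → Bool) where

  ℓ : ℕ
  ℓ = suc L

  weight : ℕ → ℕ
  weight k = q ^ k * ∏from n k (ℓ ∸ k)

  matchWeight : List (Fin q) → ℕ → ℕ
  matchWeight h k = 𝟙[ m k h ] * weight k

  capital : List (Fin q) → ℕ
  capital h = ∑[ j < ℓ ] matchWeight h (suc j)

  maxCapital : ℕ
  maxCapital = ∑[ j < ℓ ] weight (suc j)

  matchWeight≤weight : ∀ h k → matchWeight h k ≤ weight k
  matchWeight≤weight h k = ≤-trans (*-monoˡ-≤ (weight k) (𝟙≤1 (m k h))) (≤-reflexive (*-identityˡ (weight k)))

  capital≤maxCapital : ∀ h → capital h ≤ maxCapital
  capital≤maxCapital h = ∑<-mono-≤ ℓ (λ j _ → matchWeight≤weight h (suc j))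

  capital-unmatched≤ : ∀ h → m ℓ h ≡ false → capital h ≤ ∑[ j < L ] weight (suc j)
  capital-unmatched≤ h unmatched = begin
    capital h                                         ≡⟨ ∑<-snoc L (matchWeight h ∘ suc) ⟩
    ∑< L (matchWeight h ∘ suc) + 𝟙[ m ℓ h ] * weight ℓ ≡⟨ cong (λ b → ∑< L (matchWeight h ∘ suc) + 𝟙[ b ] * weight ℓ) unmatched ⟩
    ∑< L (matchWeight h ∘ suc) + 0                    ≡⟨ +-identityʳ _ ⟩
    ∑< L (matchWeight h ∘ suc)                        ≤⟨ ∑<-mono-≤ L (λ j _ → matchWeight≤weight h (suc j)) ⟩
    ∑[ j < L ] weight (suc j)                         ∎
    where open ≤-Reasoning

  capital-first+last : 1 ≤ L → ∀ h → matchWeight h 1 + matchWeight h ℓ ≤ capital h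
  capital-first+last (s≤s {n = L′} _) h = +-monoʳ-≤ (matchWeight h 1) (begin
    matchWeight h ℓ                                      ≤⟨ m≤n+m (matchWeight h ℓ) (∑< L′ (λ j → matchWeight h (suc (suc j)))) ⟩
    ∑< L′ (λ j → matchWeight h (suc (suc j))) + matchWeight h ℓ  ≡⟨ sym (∑<-snoc L′ (λ j → matchWeight h (suc (suc j)))) ⟩
    ∑< (suc L′) (λ j → matchWeight h (suc (suc j)))              ∎)
    where open ≤-Reasoning

  weight-top : weight ℓ ≡ q ^ ℓ
  weight-top = trans (cong (λ r → q ^ ℓ * ∏from n ℓ r) (n∸n≡0 ℓ)) (*-identityʳ _)

  weight-one : n 0 ≡ q → weight 1 ≡ ∏from n 0 ℓ
  weight-one n₀≡q = cong (_* ∏from n 1 L) (trans (*-identityʳ q) (sym n₀≡q))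

  weight-step : ∀ k → k < ℓ → n k * weight (suc k) ≡ q * weight k
  weight-step k (s≤s k≤L) = begin
    n k * (q ^ suc k * ∏from n (suc k) (L ∸ k))   ≡⟨ rearrange (n k) q (q ^ k) (∏from n (suc k) (L ∸ k)) ⟩
    q * (q ^ k * ∏from n k (suc (L ∸ k)))         ≡⟨ cong (λ r → q * (q ^ k * ∏from n k r)) (sym (+-∸-assoc 1 k≤L)) ⟩
    q * weight k                                  ∎
    where
    open ≡-Reasoning
    rearrange : ∀ a q x p → a * (q * x * p) ≡ q * (x * (a * p))
    rearrange = solve-∀

  extensionBound : List (Fin q) → ℕ
  extensionBound h = ∑[ j < L ] (𝟙[ m (suc j) h ] * n (suc j) * weight (suc (suc j)))

  extensionTotal : List (Fin q) → ℕ
  extensionTotal h = ∑[ j < L ] (count q (λ x → m (suc (suc j)) (x ∷ h)) * weight (suc (suc j)))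

  scaled-capital : ∀ h → q * (weight 1 + capital h) ≡ q * weight 1 + (extensionBound h + q * matchWeight h ℓ)
  scaled-capital h = begin
    q * (weight 1 + capital h)                              ≡⟨ *-distribˡ-+ q (weight 1) (capital h) ⟩
    q * weight 1 + q * capital h                            ≡⟨ cong (λ c → q * weight 1 + q * c) (∑<-snoc L term) ⟩
    q * weight 1 + q * (∑< L term + term L)                 ≡⟨ cong (q * weight 1 +_) (*-distribˡ-+ q (∑< L term) (term L)) ⟩
    q * weight 1 + (q * ∑< L term + q * term L)             ≡⟨ cong (λ c → q * weight 1 + (c + q * term L)) (sym (∑<-* L q term)) ⟩
    q * weight 1 + (∑[ j < L ] (q * term j) + q * term L)   ≡⟨ cong (λ c → q * weight 1 + (c + q * term L)) (∑<-cong L scaled-term) ⟩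
    q * weight 1 + (extensionBound h + q * matchWeight h ℓ) ∎
    where
    open ≡-Reasoning
    term : ℕ → ℕ
    term = matchWeight h ∘ suc
    scaled-term : ∀ j → j < L → q * term j ≡ 𝟙[ m (suc j) h ] * n (suc j) * weight (suc (suc j))
    scaled-term j j<L = begin
      q * (𝟙[ m (suc j) h ] * weight (suc j))               ≡⟨ x*[y*z]≡y*[x*z] q 𝟙[ m (suc j) h ] (weight (suc j)) ⟩
      𝟙[ m (suc j) h ] * (q * weight (suc j))               ≡⟨ cong (𝟙[ m (suc j) h ] *_) (sym (weight-step (suc j) (s≤s j<L))) ⟩
      𝟙[ m (suc j) h ] * (n (suc j) * weight (suc (suc j))) ≡⟨ sym (*-assoc 𝟙[ m (suc j) h ] _ _) ⟩
      𝟙[ m (suc j) h ] * n (suc j) * weight (suc (suc j))   ∎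

  module Drift (m₁ : ∀ x h → m 1 (x ∷ h) ≡ true) where

    capital-∷ : ∀ h → ∑[ x ∈ allFin q ] capital (x ∷ h) ≡ q * weight 1 + extensionTotal h
    capital-∷ h = begin
      ∑[ x ∈ allFin q ] capital (x ∷ h)
        ≡⟨ ∑-+ (λ x → matchWeight (x ∷ h) 1) (λ x → ∑< L (term x)) (allFin q) ⟩
      ∑[ x ∈ allFin q ] matchWeight (x ∷ h) 1 + ∑[ x ∈ allFin q ] ∑< L (term x)
        ≡⟨ cong₂ _+_ first-term (∑-∑<-comm (allFin q) L term) ⟩
      q * weight 1 + ∑[ j < L ] ∑[ x ∈ allFin q ] term x j
        ≡⟨ cong (q * weight 1 +_) (∑<-cong L (λ j _ → count-term j)) ⟩
      q * weight 1 + extensionTotal h ∎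
      where
      open ≡-Reasoning
      term : Fin q → ℕ → ℕ
      term x j = matchWeight (x ∷ h) (suc (suc j))
      first-term : ∑[ x ∈ allFin q ] matchWeight (x ∷ h) 1 ≡ q * weight 1
      first-term = trans (∑-cong (allFin q) (λ x → trans (cong (λ b → 𝟙[ b ] * weight 1) (m₁ x h)) (*-identityˡ _)))
                         (∑-allFin-const q (weight 1))
      count-term : ∀ j → ∑[ x ∈ allFin q ] term x j ≡ count q (λ x → m (suc (suc j)) (x ∷ h)) * weight (suc (suc j))
      count-term j = trans (∑-cong (allFin q) (λ x → *-comm 𝟙[ m (suc (suc j)) (x ∷ h) ] _))
                           (trans (∑-* (weight (suc (suc j))) _ (allFin q)) (*-comm (weight (suc (suc j))) _))

    capital-drift-≤ : (∀ j h → j < L → count q (λ x → m (suc (suc j)) (x ∷ h)) ≤ 𝟙[ m (suc j) h ] * n (suc j)) →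
                      ∀ h → ∑[ x ∈ allFin q ] capital (x ∷ h) ≤ q * (weight 1 + capital h)
    capital-drift-≤ extensions≤ h = begin
      ∑[ x ∈ allFin q ] capital (x ∷ h)                        ≡⟨ capital-∷ h ⟩
      q * weight 1 + extensionTotal h                          ≤⟨ +-monoʳ-≤ (q * weight 1) total≤bound ⟩
      q * weight 1 + extensionBound h                          ≤⟨ +-monoʳ-≤ (q * weight 1) (m≤m+n _ _) ⟩
      q * weight 1 + (extensionBound h + q * matchWeight h ℓ)  ≡⟨ sym (scaled-capital h) ⟩
      q * (weight 1 + capital h)                               ∎
      where
      open ≤-Reasoning
      total≤bound : extensionTotal h ≤ extensionBound h
      total≤bound = ∑<-mono-≤ L (λ j j<L → *-monoˡ-≤ (weight (suc (suc j))) (extensions≤ j h j<L))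

    capital-drift-≥ : (∀ j h → j < L → 𝟙[ m (suc j) h ] * n (suc j) ≤ count q (λ x → m (suc (suc j)) (x ∷ h))) →
                      ∀ h → m ℓ h ≡ false → q * (weight 1 + capital h) ≤ ∑[ x ∈ allFin q ] capital (x ∷ h)
    capital-drift-≥ extensions≥ h unmatched = begin
      q * (weight 1 + capital h)                               ≡⟨ scaled-capital h ⟩
      q * weight 1 + (extensionBound h + q * matchWeight h ℓ)
        ≡⟨ cong (λ b → q * weight 1 + (extensionBound h + q * (𝟙[ b ] * weight ℓ))) unmatched ⟩
      q * weight 1 + (extensionBound h + q * 0)
        ≡⟨ cong (q * weight 1 +_) (trans (cong (extensionBound h +_) (*-zeroʳ q)) (+-identityʳ _)) ⟩
      q * weight 1 + extensionBound h                          ≤⟨ +-monoʳ-≤ (q * weight 1) bound≤total ⟩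
      q * weight 1 + extensionTotal h                          ≡⟨ sym (capital-∷ h) ⟩
      ∑[ x ∈ allFin q ] capital (x ∷ h)                        ∎
      where
      open ≤-Reasoning
      bound≤total : extensionBound h ≤ extensionTotal h
      bound≤total = ∑<-mono-≤ L (λ j j<L → *-monoˡ-≤ (weight (suc (suc j))) (extensions≥ j h j<L))

-- Optional stopping for the race

isUndecided : Outcome → Bool
isUndecided undecided = true
isUndecided _         = false

module Race {q L : ℕ} (t₁ t₂ : Word q (suc L) → Bool) where

  ℓ : ℕ
  ℓ = suc L

  decided : List (Fin q) → Bool
  decided h = hits ℓ t₁ h ∨ hits ℓ t₂ h

  stopped : List (Fin q) → List (Fin q) → List (Fin q)
  stopped h []      = h
  stopped h (x ∷ r) = if decided (x ∷ h) then x ∷ h else stopped (x ∷ h) r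

  stoppedSum : (List (Fin q) → ℕ) → List (Fin q) → ℕ → ℕ
  stoppedSum g h n = ∑[ u ∈ allWords q n ] g (stopped h (vecToList u))

  outcomeSum : (Outcome → ℕ) → List (Fin q) → ℕ → ℕ
  outcomeSum f h n = ∑[ u ∈ allWords q n ] f (race ℓ t₁ t₂ h (vecToList u))

  #outcome : (Outcome → Bool) → List (Fin q) → ℕ → ℕ
  #outcome o = outcomeSum (λ r → 𝟙[ o r ])

  #outcome-total : ∀ h n → #outcome isFirst h n + #outcome isSecond h n + #outcome isUndecided h n ≡ q ^ n
  #outcome-total h n = begin
    #outcome isFirst h n + #outcome isSecond h n + #outcome isUndecided h n
      ≡⟨ cong (_+ #outcome isUndecided h n) (sym (∑-+ _ _ (allWords q n))) ⟩
    outcomeSum (λ r → 𝟙[ isFirst r ] + 𝟙[ isSecond r ]) h n + #outcome isUndecided h n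
      ≡⟨ sym (∑-+ _ _ (allWords q n)) ⟩
    outcomeSum (λ r → 𝟙[ isFirst r ] + 𝟙[ isSecond r ] + 𝟙[ isUndecided r ]) h n
      ≡⟨ ∑-cong (allWords q n) (λ u → exactly-one (race ℓ t₁ t₂ h (vecToList u))) ⟩
    ∑[ u ∈ allWords q n ] 1
      ≡⟨ trans (∑-allWords-const q n 1) (*-identityʳ _) ⟩
    q ^ n ∎
    where
    open ≡-Reasoning
    exactly-one : ∀ r → 𝟙[ isFirst r ] + 𝟙[ isSecond r ] + 𝟙[ isUndecided r ] ≡ 1
    exactly-one first     = refl
    exactly-one second    = refl
    exactly-one undecided = refl

  data Stop : Outcome → List (Fin q) → Set where
    stop-undecided : ∀ h → Stop undecided h
    stop-first     : ∀ x h → Stop first (x ∷ h)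
    stop-second    : ∀ x h → hits ℓ t₁ (x ∷ h) ≡ false → hits ℓ t₂ (x ∷ h) ≡ true → Stop second (x ∷ h)

  race-stops : ∀ h r → Stop (race ℓ t₁ t₂ h r) (stopped h r)
  race-stops h []      = stop-undecided h
  race-stops h (x ∷ r) = by-hits (hits ℓ t₁ (x ∷ h)) (hits ℓ t₂ (x ∷ h)) refl refl
    where
    by-hits : ∀ b₁ b₂ → hits ℓ t₁ (x ∷ h) ≡ b₁ → hits ℓ t₂ (x ∷ h) ≡ b₂ →
              Stop (if b₁ then first else if b₂ then second else race ℓ t₁ t₂ (x ∷ h) r)
                   (if b₁ ∨ b₂ then x ∷ h else stopped (x ∷ h) r)
    by-hits true  _     _   _   = stop-first x h
    by-hits false true  t₁✗ t₂✓ = stop-second x h t₁✗ t₂✓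
    by-hits false false _   _   = race-stops (x ∷ h) r

  stoppedSum-≤ : ∀ {g f} h n → (∀ r s → Stop r s → g s ≤ f r) → stoppedSum g h n ≤ outcomeSum f h n
  stoppedSum-≤ h n g≤f = ∑-mono-≤ (allWords q n) (λ u → g≤f _ _ (race-stops h (vecToList u)))

  stoppedSum-≥ : ∀ {g f} h n → (∀ r s → Stop r s → f r ≤ g s) → outcomeSum f h n ≤ stoppedSum g h n
  stoppedSum-≥ h n f≤g = ∑-mono-≤ (allWords q n) (λ u → f≤g _ _ (race-stops h (vecToList u)))

  nextStopped : (List (Fin q) → ℕ) → List (Fin q) → ℕ → Fin q → ℕ
  nextStopped g h n x = if decided (x ∷ h) then q ^ n * g (x ∷ h) else stoppedSum g (x ∷ h) n

  stoppedSum-suc : ∀ g h n → stoppedSum g h (suc n) ≡ ∑[ x ∈ allFin q ] nextStopped g h n x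
  stoppedSum-suc g h n = trans (∑-allWords-suc q n _) (∑-cong (allFin q) first-letter)
    where
    first-letter : ∀ x → ∑[ u ∈ allWords q n ] g (if decided (x ∷ h) then x ∷ h else stopped (x ∷ h) (vecToList u))
                         ≡ nextStopped g h n x
    first-letter x with decided (x ∷ h)
    ... | true  = ∑-allWords-const q n (g (x ∷ h))
    ... | false = refl

  #undecided-suc : ∀ h n → #outcome isUndecided h (suc n)
                           ≡ ∑[ x ∈ allFin q ] (if decided (x ∷ h) then 0 else #outcome isUndecided (x ∷ h) n)
  #undecided-suc h n = trans (∑-allWords-suc q n _) (∑-cong (allFin q) first-letter)
    where
    first-letter : ∀ x → ∑[ u ∈ allWords q n ] 𝟙[ isUndecided (if hits ℓ t₁ (x ∷ h) then first
                                                 else if hits ℓ t₂ (x ∷ h) then second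
                                                 else race ℓ t₁ t₂ (x ∷ h) (vecToList u)) ]
                         ≡ (if decided (x ∷ h) then 0 else #outcome isUndecided (x ∷ h) n)
    first-letter x with hits ℓ t₁ (x ∷ h) | hits ℓ t₂ (x ∷ h)
    ... | true  | _     = trans (∑-allWords-const q n 0) (*-zeroʳ (q ^ n))
    ... | false | true  = trans (∑-allWords-const q n 0) (*-zeroʳ (q ^ n))
    ... | false | false = refl

  #undecided≤ : ∀ h n → #outcome isUndecided h n ≤ q ^ n
  #undecided≤ h n = ≤-trans (∑-mono-≤ (allWords q n) (λ u → 𝟙≤1 (isUndecided (race ℓ t₁ t₂ h (vecToList u)))))
                            (≤-reflexive (trans (∑-allWords-const q n 1) (*-identityʳ _)))

  module OptionalStopping
    (Gᴬ Gᴮ : List (Fin q) → ℕ) (a b : ℕ) (Alive : List (Fin q) → Set)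
    (stays-alive : ∀ x h → decided (x ∷ h) ≡ false → Alive (x ∷ h))
    (driftᴬ : ∀ h → Alive h → q * (a + Gᴬ h) ≤ ∑[ x ∈ allFin q ] Gᴬ (x ∷ h))
    (driftᴮ : ∀ h → ∑[ x ∈ allFin q ] Gᴮ (x ∷ h) ≤ q * (b + Gᴮ h)) where

    optional-stopping : ∀ n h → Alive h →
      a * stoppedSum Gᴮ h n + q ^ n * b * Gᴬ h ≤ b * stoppedSum Gᴬ h n + q ^ n * a * Gᴮ h
    optional-stopping zero    h _     = ≤-reflexive (base a b (Gᴮ h) (Gᴬ h))
      where
      base : ∀ a b x y → a * (x + 0) + 1 * b * y ≡ b * (y + 0) + 1 * a * x
      base = solve-∀
    optional-stopping (suc n) h alive = +-cancelˡ-≤ (q ^ suc n * a * b) _ _ (begin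
      q ^ suc n * a * b + (a * stoppedSum Gᴮ h (suc n) + q ^ suc n * b * Gᴬ h)
        ≡⟨ pay-drift (q ^ n) q a b (stoppedSum Gᴮ h (suc n)) (Gᴬ h) ⟩
      a * stoppedSum Gᴮ h (suc n) + q ^ n * b * (q * (a + Gᴬ h))
        ≤⟨ +-monoʳ-≤ (a * stoppedSum Gᴮ h (suc n)) (*-monoʳ-≤ (q ^ n * b) (driftᴬ h alive)) ⟩
      a * stoppedSum Gᴮ h (suc n) + q ^ n * b * ∑[ x ∈ allFin q ] Gᴬ (x ∷ h)
        ≡⟨ by-first-letter a (q ^ n * b) Gᴮ Gᴬ ⟩
      ∑[ x ∈ allFin q ] (a * nextStopped Gᴮ h n x + q ^ n * b * Gᴬ (x ∷ h))
        ≤⟨ ∑-mono-≤ (allFin q) per-letter ⟩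
      ∑[ x ∈ allFin q ] (b * nextStopped Gᴬ h n x + q ^ n * a * Gᴮ (x ∷ h))
        ≡⟨ sym (by-first-letter b (q ^ n * a) Gᴬ Gᴮ) ⟩
      b * stoppedSum Gᴬ h (suc n) + q ^ n * a * ∑[ x ∈ allFin q ] Gᴮ (x ∷ h)
        ≤⟨ +-monoʳ-≤ (b * stoppedSum Gᴬ h (suc n)) (*-monoʳ-≤ (q ^ n * a) (driftᴮ h)) ⟩
      b * stoppedSum Gᴬ h (suc n) + q ^ n * a * (q * (b + Gᴮ h))
        ≡⟨ collect-drift (q ^ n) q a b (stoppedSum Gᴬ h (suc n)) (Gᴮ h) ⟩
      q ^ suc n * a * b + (b * stoppedSum Gᴬ h (suc n) + q ^ suc n * a * Gᴮ h) ∎)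
      where
      open ≤-Reasoning
      pay-drift : ∀ z q a b s y → q * z * a * b + (a * s + q * z * b * y) ≡ a * s + z * b * (q * (a + y))
      pay-drift = solve-∀
      collect-drift : ∀ z q a b s y → b * s + z * a * (q * (b + y)) ≡ q * z * a * b + (b * s + q * z * a * y)
      collect-drift = solve-∀
      by-first-letter : ∀ c d (g g′ : List (Fin q) → ℕ) →
        c * stoppedSum g h (suc n) + d * ∑[ x ∈ allFin q ] g′ (x ∷ h)
        ≡ ∑[ x ∈ allFin q ] (c * nextStopped g h n x + d * g′ (x ∷ h))
      by-first-letter c d g g′ =
        trans (cong (λ s → c * s + d * ∑[ x ∈ allFin q ] g′ (x ∷ h)) (stoppedSum-suc g h n))
              (sym (∑-linear c d (nextStopped g h n) (λ x → g′ (x ∷ h)) (allFin q)))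
      per-letter : ∀ x → a * nextStopped Gᴮ h n x + q ^ n * b * Gᴬ (x ∷ h)
                         ≤ b * nextStopped Gᴬ h n x + q ^ n * a * Gᴮ (x ∷ h)
      per-letter x with decided (x ∷ h) in x∷h-decided
      ... | true  = ≤-reflexive (stopped-now a b (q ^ n) (Gᴮ (x ∷ h)) (Gᴬ (x ∷ h)))
        where
        stopped-now : ∀ a b z x y → a * (z * x) + z * b * y ≡ b * (z * y) + z * a * x
        stopped-now = solve-∀
      ... | false = optional-stopping n (x ∷ h) (stays-alive x h x∷h-decided)

    undecided-decay : ∀ n h → Alive h → q ^ n * Gᴬ h + a * n * #outcome isUndecided h n ≤ stoppedSum Gᴬ h n
    undecided-decay zero    h _     = ≤-reflexive (base a (Gᴬ h) (#outcome isUndecided h zero))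
      where
      base : ∀ a y u → 1 * y + a * 0 * u ≡ y + 0
      base = solve-∀
    undecided-decay (suc n) h alive = begin
      q ^ suc n * Gᴬ h + a * suc n * U
        ≡⟨ split-n (q ^ n) q (Gᴬ h) a n U ⟩
      q ^ suc n * Gᴬ h + a * U + a * n * U
        ≤⟨ +-monoˡ-≤ (a * n * U) (+-monoʳ-≤ (q ^ suc n * Gᴬ h) (*-monoʳ-≤ a (#undecided≤ h (suc n)))) ⟩
      q ^ suc n * Gᴬ h + a * q ^ suc n + a * n * U
        ≡⟨ cong (_+ a * n * U) (factor (q ^ n) q (Gᴬ h) a) ⟩
      q ^ n * (q * (a + Gᴬ h)) + a * n * U
        ≤⟨ +-monoˡ-≤ (a * n * U) (*-monoʳ-≤ (q ^ n) (driftᴬ h alive)) ⟩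
      q ^ n * ∑[ x ∈ allFin q ] Gᴬ (x ∷ h) + a * n * U
        ≡⟨ cong₂ _+_ refl (cong (a * n *_) (#undecided-suc h n)) ⟩
      q ^ n * ∑[ x ∈ allFin q ] Gᴬ (x ∷ h) + a * n * ∑[ x ∈ allFin q ] undecidedAfter x
        ≡⟨ sym (∑-linear (q ^ n) (a * n) (λ x → Gᴬ (x ∷ h)) undecidedAfter (allFin q)) ⟩
      ∑[ x ∈ allFin q ] (q ^ n * Gᴬ (x ∷ h) + a * n * undecidedAfter x)
        ≤⟨ ∑-mono-≤ (allFin q) per-letter ⟩
      ∑[ x ∈ allFin q ] nextStopped Gᴬ h n x
        ≡⟨ sym (stoppedSum-suc Gᴬ h n) ⟩
      stoppedSum Gᴬ h (suc n) ∎
      where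
      open ≤-Reasoning
      U : ℕ
      U = #outcome isUndecided h (suc n)
      undecidedAfter : Fin q → ℕ
      undecidedAfter x = if decided (x ∷ h) then 0 else #outcome isUndecided (x ∷ h) n
      split-n : ∀ z q y a n u → q * z * y + a * suc n * u ≡ q * z * y + a * u + a * n * u
      split-n = solve-∀
      factor : ∀ z q y a → q * z * y + a * (q * z) ≡ z * (q * (a + y))
      factor = solve-∀
      per-letter : ∀ x → q ^ n * Gᴬ (x ∷ h) + a * n * undecidedAfter x ≤ nextStopped Gᴬ h n x
      per-letter x with decided (x ∷ h) in x∷h-decided
      ... | true  = ≤-reflexive (trans (cong (q ^ n * Gᴬ (x ∷ h) +_) (*-zeroʳ (a * n))) (+-identityʳ _))
      ... | false = undecided-decay n (x ∷ h) (stays-alive x h x∷h-decided)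

first-ahead : ∀ {X K F S U Q} → suc X * S ≤ X * F + K * U → F + S + U ≡ Q → (6 * K + 2) * U ≤ Q →
              4 * suc X * S + Q ≤ 4 * suc X * F
first-ahead {X} {K} {F} {S} {U} {Q} bias total U-small = +-cancelʳ-≤ (4 * E) _ _ (begin
  4 * Y * S + Q + 4 * E    ≡⟨ reassoc X S Q E ⟩
  4 * (Y * S) + (Q + 4 * E) ≤⟨ +-monoʳ-≤ (4 * (Y * S)) Q+4E≤4F ⟩
  4 * (Y * S) + 4 * F       ≡⟨ sym (*-distribˡ-+ 4 (Y * S) F) ⟩
  4 * (Y * S + F)           ≤⟨ *-monoʳ-≤ 4 YS+F≤YF+E ⟩
  4 * (Y * F + E)           ≡⟨ distrib X F E ⟩
  4 * Y * F + 4 * E         ∎)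
  where
  open ≤-Reasoning
  Y E : ℕ
  Y = suc X
  E = K * U
  YS+F≤YF+E : Y * S + F ≤ Y * F + E
  YS+F≤YF+E = begin
    Y * S + F      ≤⟨ +-monoˡ-≤ F bias ⟩
    X * F + E + F  ≡⟨ rotate (X * F) E F ⟩
    Y * F + E      ∎
    where
    rotate : ∀ a b c → a + b + c ≡ c + a + b
    rotate = solve-∀
  S≤F+E : S ≤ F + E
  S≤F+E = *-cancelˡ-≤ Y (begin
    Y * S          ≤⟨ m≤m+n (Y * S) F ⟩
    Y * S + F      ≤⟨ YS+F≤YF+E ⟩
    Y * F + E      ≤⟨ +-monoʳ-≤ (Y * F) (m≤m+n E (X * E)) ⟩
    Y * F + Y * E  ≡⟨ sym (*-distribˡ-+ Y F E) ⟩
    Y * (F + E)    ∎)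
  Q≤2F+E+U : Q ≤ 2 * F + E + U
  Q≤2F+E+U = begin
    Q                ≡⟨ sym total ⟩
    F + S + U        ≤⟨ +-monoˡ-≤ U (+-monoʳ-≤ F S≤F+E) ⟩
    F + (F + E) + U  ≡⟨ double F E U ⟩
    2 * F + E + U    ∎
    where
    double : ∀ f e u → f + (f + e) + u ≡ 2 * f + e + u
    double = solve-∀
  Q+4E≤4F : Q + 4 * E ≤ 4 * F
  Q+4E≤4F = +-cancelʳ-≤ (2 * E + 2 * U) _ _ (begin
    Q + 4 * E + (2 * E + 2 * U)      ≡⟨ regroup Q K U ⟩
    Q + (6 * K + 2) * U              ≤⟨ +-monoʳ-≤ Q U-small ⟩
    Q + Q                            ≤⟨ +-mono-≤ Q≤2F+E+U Q≤2F+E+U ⟩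
    2 * F + E + U + (2 * F + E + U)  ≡⟨ collect F E U ⟩
    4 * F + (2 * E + 2 * U)          ∎)
    where
    regroup : ∀ q k u → q + 4 * (k * u) + (2 * (k * u) + 2 * u) ≡ q + (6 * k + 2) * u
    regroup = solve-∀
    collect : ∀ f e u → 2 * f + e + u + (2 * f + e + u) ≡ 4 * f + (2 * e + 2 * u)
    collect = solve-∀
  reassoc : ∀ x s q e → 4 * suc x * s + q + 4 * e ≡ 4 * (suc x * s) + (q + 4 * e)
  reassoc = solve-∀
  distrib : ∀ x f e → 4 * (suc x * f + e) ≡ 4 * suc x * f + 4 * e
  distrib = solve-∀

bias-from-stopping : ∀ {a b F S U G R Qℓ} →
  a * (b * F + (b + Qℓ) * S) ≤ b * ((G + Qℓ) * F + G * S + (G + Qℓ) * U) →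
  G ≤ a + R → b * (2 * R + Qℓ) + 1 ≤ a * Qℓ →
  suc (b * (R + Qℓ)) * S ≤ b * (R + Qℓ) * F + b * (G + Qℓ) * U
bias-from-stopping {a} {b} {F} {S} {U} {G} {R} {Qℓ} stopping G≤a+R gap =
  +-cancelˡ-≤ (b * R * S) _ _ (begin
    b * R * S + suc (b * (R + Qℓ)) * S  ≡⟨ expand b R Qℓ S ⟩
    (b * (2 * R + Qℓ) + 1) * S          ≤⟨ *-monoˡ-≤ S gap ⟩
    a * Qℓ * S                          ≤⟨ aQℓS≤ ⟩
    b * (R + Qℓ) * F + b * R * S + E    ≡⟨ swap (b * (R + Qℓ) * F) (b * R * S) E ⟩
    b * R * S + (b * (R + Qℓ) * F + E)  ∎)
  where
  open ≤-Reasoning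
  E : ℕ
  E = b * (G + Qℓ) * U
  aQℓS≤ : a * Qℓ * S ≤ b * (R + Qℓ) * F + b * R * S + E
  aQℓS≤ = +-cancelˡ-≤ (a * b * F + a * b * S) _ _ (begin
    a * b * F + a * b * S + a * Qℓ * S
      ≡⟨ factor a b F S Qℓ ⟩
    a * (b * F + (b + Qℓ) * S)
      ≤⟨ stopping ⟩
    b * ((G + Qℓ) * F + G * S + E′)
      ≤⟨ *-monoʳ-≤ b (+-monoˡ-≤ E′ (+-mono-≤ (*-monoˡ-≤ F (+-monoˡ-≤ Qℓ G≤a+R)) (*-monoˡ-≤ S G≤a+R))) ⟩
    b * ((a + R + Qℓ) * F + (a + R) * S + E′)
      ≡⟨ distribute a b F S R Qℓ E′ ⟩
    a * b * F + a * b * S + (b * (R + Qℓ) * F + b * R * S + b * E′)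
      ≡⟨ cong (λ e → a * b * F + a * b * S + (b * (R + Qℓ) * F + b * R * S + e)) (sym (*-assoc b (G + Qℓ) U)) ⟩
    a * b * F + a * b * S + (b * (R + Qℓ) * F + b * R * S + E) ∎)
    where
    E′ : ℕ
    E′ = (G + Qℓ) * U
    factor : ∀ a b F S Qℓ → a * b * F + a * b * S + a * Qℓ * S ≡ a * (b * F + (b + Qℓ) * S)
    factor = solve-∀
    distribute : ∀ a b F S R Qℓ e → b * ((a + R + Qℓ) * F + (a + R) * S + e)
                 ≡ a * b * F + a * b * S + (b * (R + Qℓ) * F + b * R * S + b * e)
    distribute = solve-∀
  expand : ∀ b R Qℓ S → b * R * S + suc (b * (R + Qℓ)) * S ≡ (b * (2 * R + Qℓ) + 1) * S
  expand = solve-∀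
  swap : ∀ x y z → x + y + z ≡ y + (x + z)
  swap = solve-∀

-- The hypothesis 2ℓ < q + 2 of the theorem (here ℓ = L′ + 2) is used only here.
extension-gap : ∀ L′ q → 2 * L′ + 3 ≤ q → 2 * L′ * (q ∸ suc L′) + q + 1 ≤ (q ∸ suc L′) * q
extension-gap L′ q 2L′+3≤q with m≤n⇒∃[o]m+o≡n 2L′+3≤q
... | e , refl = subst (λ A → 2 * L′ * A + (2 * L′ + 3 + e) + 1 ≤ A * (2 * L′ + 3 + e)) (sym (q∸ℓ L′ e))
                       (≤-trans (m≤m+n _ _) (≤-reflexive (expand L′ e)))
  where
  q∸ℓ : ∀ L′ e → 2 * L′ + 3 + e ∸ suc L′ ≡ L′ + 2 + e
  q∸ℓ L′ e = trans (cong (_∸ suc L′) (split L′ e)) (m+n∸m≡n (suc L′) (L′ + 2 + e))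
    where
    split : ∀ L′ e → 2 * L′ + 3 + e ≡ suc L′ + (L′ + 2 + e)
    split = solve-∀
  expand : ∀ L′ e → 2 * L′ * (L′ + 2 + e) + (2 * L′ + 3 + e) + 1 + (L′ + L′ * e + 2 + 4 * e + e * e)
                    ≡ (L′ + 2 + e) * (2 * L′ + 3 + e)
  expand = solve-∀

cost-gap : ∀ {b P A′ L′ x q} → b ≤ P → 1 ≤ P → 1 ≤ x → 2 * L′ * A′ + q + 1 ≤ A′ * q →
           b * (2 * (L′ * (x * A′)) + q * x) + 1 ≤ P * A′ * (q * x)
cost-gap {b} {P} {A′} {L′} {x} {q} b≤P 1≤P 1≤x gap = begin
  b * (2 * (L′ * (x * A′)) + q * x) + 1  ≤⟨ +-mono-≤ (*-monoˡ-≤ _ b≤P) 1≤P ⟩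
  P * (2 * (L′ * (x * A′)) + q * x) + P  ≡⟨ factor P L′ x A′ q ⟩
  P * (x * (2 * L′ * A′ + q) + 1)        ≤⟨ *-monoʳ-≤ P (+-monoʳ-≤ (x * (2 * L′ * A′ + q)) 1≤x) ⟩
  P * (x * (2 * L′ * A′ + q) + x)        ≡⟨ cong (P *_) (sym (*-suc′ x (2 * L′ * A′ + q))) ⟩
  P * (x * (2 * L′ * A′ + q + 1))        ≤⟨ *-monoʳ-≤ P (*-monoʳ-≤ x gap) ⟩
  P * (x * (A′ * q))                     ≡⟨ regroup P x A′ q ⟩
  P * A′ * (q * x)                       ∎
  where
  open ≤-Reasoning
  factor : ∀ P L′ x A′ q → P * (2 * (L′ * (x * A′)) + q * x) + P ≡ P * (x * (2 * L′ * A′ + q) + 1)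
  factor = solve-∀
  *-suc′ : ∀ x y → x * (y + 1) ≡ x * y + x
  *-suc′ = solve-∀
  regroup : ∀ P x A′ q → P * (x * (A′ * q)) ≡ P * A′ * (q * x)
  regroup = solve-∀

length-bound : ∀ L q → 2 * suc L < q + 2 → 2 * L + 1 ≤ q
length-bound L q 2ℓ<q+2 = +-cancelʳ-≤ 2 (2 * L + 1) q (subst (_≤ q + 2) (shift L) 2ℓ<q+2)
  where
  shift : ∀ L → suc (2 * suc L) ≡ 2 * L + 1 + 2
  shift = solve-∀

eventually-first-ahead : ∀ {F S U : ℕ → ℕ} {q N₀} →
  (∀ n → F n + S n + U n ≡ q ^ n) → (∀ M n → M * N₀ ≤ n → M * U n ≤ q ^ n) →
  ∃[ X ] ∃[ K ] (∀ n → suc X * S n ≤ X * F n + K * U n) →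
  ∃[ c ] ∃[ d ] ∃[ N ] (1 ≤ c × (∀ n → N ≤ n → d * S n + c * q ^ n ≤ d * F n))
eventually-first-ahead {F} {S} {U} {q} {N₀} total undecided-small (X , K , bias) =
  1 , 4 * suc X , (6 * K + 2) * N₀ , ≤-refl , λ n N≤n →
    subst (λ Q → 4 * suc X * S n + Q ≤ 4 * suc X * F n) (sym (*-identityˡ (q ^ n)))
          (first-ahead {X} {K} {F n} {S n} {U n} (bias n) (total n) (undecided-small (6 * K + 2) n N≤n))

-- The race of a₁⋯aℓ against the orbit of w

module DistinctVersusOrbit (q L : ℕ) (w : Word q (suc L))
            (dec₁ : Decidable (Distinct {q} {suc L})) (dec₂ : Decidable (InOrbit w)) where

  open Race (test dec₁) (test dec₂) public

  F S U : ℕ → ℕ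
  F = #outcome isFirst []
  S = #outcome isSecond []
  U = #outcome isUndecided []

  Bias : Set
  Bias = ∃[ X ] ∃[ K ] (∀ n → suc X * S n ≤ X * F n + K * U n)

  module A = Capital q L (q ∸_) distinctPrefixᵇ

  wᵣ : ℕ → List (Fin q)
  wᵣ = reversedPrefix (vecToList w) (lookup w zero)

  extensionsᴮ : ℕ → ℕ
  extensionsᴮ k = choices q (nth (vecToList w) k (lookup w zero)) (wᵣ k)

  matchesᴮ : ℕ → List (Fin q) → Bool
  matchesᴮ k h = samePatternᵇ (take k h) (wᵣ k)

  module B = Capital q L extensionsᴮ matchesᴮ

  ∏from-extensionsᴮ : ∀ k → ∏from extensionsᴮ 0 k ≡ q ↓ #distinct (wᵣ k)
  ∏from-extensionsᴮ zero    = refl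
  ∏from-extensionsᴮ (suc k) = begin
    ∏from extensionsᴮ 0 (suc k)            ≡⟨ ∏from-snoc extensionsᴮ 0 k ⟩
    ∏from extensionsᴮ 0 k * extensionsᴮ k  ≡⟨ cong (_* extensionsᴮ k) (∏from-extensionsᴮ k) ⟩
    q ↓ #distinct (wᵣ k) * extensionsᴮ k   ≡⟨ ↓-choices q (#distinct (wᵣ k)) (nth (vecToList w) k (lookup w zero) ∈ᵇ wᵣ k) ⟩
    q ↓ #distinct (wᵣ (suc k))             ∎
    where open ≡-Reasoning

  a b : ℕ
  a = A.weight 1
  b = B.weight 1

  distinctPrefix⇒hit : ∀ h → distinctPrefixᵇ ℓ h ≡ true → hits ℓ (test dec₁) h ≡ true
  distinctPrefix⇒hit h d with window-defined ℓ h (distinctPrefix⇒≤length ℓ h d)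
  ... | v , window≡v =
    trans (hits-window ℓ (test dec₁) h v window≡v) (dec-true (dec₁ v) (#distinct≡length⇒Distinct v #v≡ℓ))
    where
    #v≡ℓ : #distinct (vecToList v) ≡ ℓ
    #v≡ℓ = begin
      #distinct (vecToList v)            ≡⟨ sym (#distinct-reverse (vecToList v)) ⟩
      #distinct (reverse (vecToList v))  ≡⟨ cong #distinct (sym (window⇒take ℓ h v window≡v)) ⟩
      #distinct (take ℓ h)               ≡⟨ distinctPrefix⇒#distinct ℓ h d ⟩
      ℓ                                  ∎
      where open ≡-Reasoning

  no-hit⇒A-unmatched : ∀ h → hits ℓ (test dec₁) h ≡ false → distinctPrefixᵇ ℓ h ≡ false
  no-hit⇒A-unmatched h no-hit with distinctPrefixᵇ ℓ h in d
  ... | true  with () ← trans (sym (distinctPrefix⇒hit h d)) no-hit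
  ... | false = refl

  hit⇒B-matched : ∀ h → hits ℓ (test dec₂) h ≡ true → matchesᴮ ℓ h ≡ true
  hit⇒B-matched h hit with hits⇒window ℓ (test dec₂) h hit
  ... | v , window≡v , t₂v =
    trans (cong₂ samePatternᵇ (window⇒take ℓ h v window≡v) (reversedPrefix-all w (lookup w zero)))
          (orbit⇒samePattern w v (does⇒ (dec₂ v) t₂v))

  driftᴬ : ∀ h → distinctPrefixᵇ ℓ h ≡ false → q * (a + A.capital h) ≤ ∑[ x ∈ allFin q ] A.capital (x ∷ h)
  driftᴬ = A.Drift.capital-drift-≥ (λ _ _ → refl) (λ j h _ → ≤-reflexive (sym (count-distinctPrefix-∷ (suc j) h)))

  driftᴮ : ∀ h → ∑[ x ∈ allFin q ] B.capital (x ∷ h) ≤ q * (b + B.capital h)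
  driftᴮ = B.Drift.capital-drift-≤ (λ _ _ → refl)
             (λ j h _ → count-samePattern-∷ (take (suc j) h) (nth (vecToList w) (suc j) (lookup w zero)) (wᵣ (suc j)))

  stays-alive : ∀ x h → decided (x ∷ h) ≡ false → distinctPrefixᵇ ℓ (x ∷ h) ≡ false
  stays-alive x h no-hit = no-hit⇒A-unmatched (x ∷ h) (∨-conicalˡ _ _ no-hit)

  open OptionalStopping A.capital B.capital a b (λ h → distinctPrefixᵇ ℓ h ≡ false) stays-alive driftᴬ driftᴮ

  Gmax Gmax⁻ : ℕ
  Gmax  = A.maxCapital
  Gmax⁻ = ∑[ j < L ] A.weight (suc j)

  Gmax-split : Gmax ≡ Gmax⁻ + q ^ ℓ
  Gmax-split = trans (∑<-snoc L (λ j → A.weight (suc j))) (cong (Gmax⁻ +_) A.weight-top)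

  capitalᴬ-at-stop : ∀ r s → Stop r s →
    A.capital s ≤ Gmax * 𝟙[ isFirst r ] + Gmax⁻ * 𝟙[ isSecond r ] + Gmax * 𝟙[ isUndecided r ]
  capitalᴬ-at-stop _ s (stop-undecided .s) =
    ≤-trans (A.capital≤maxCapital s) (≤-reflexive (only-third Gmax Gmax⁻))
    where
    only-third : ∀ x y → x ≡ x * 0 + y * 0 + x * 1
    only-third = solve-∀
  capitalᴬ-at-stop _ _ (stop-first x s) =
    ≤-trans (A.capital≤maxCapital (x ∷ s)) (≤-reflexive (only-first Gmax Gmax⁻))
    where
    only-first : ∀ x y → x ≡ x * 1 + y * 0 + x * 0
    only-first = solve-∀
  capitalᴬ-at-stop _ _ (stop-second x s no-hit₁ _) =
    ≤-trans (A.capital-unmatched≤ (x ∷ s) (no-hit⇒A-unmatched (x ∷ s) no-hit₁)) (≤-reflexive (only-second Gmax Gmax⁻))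
    where
    only-second : ∀ x y → y ≡ x * 0 + y * 1 + x * 0
    only-second = solve-∀

  capitalᴮ-at-stop : 1 ≤ L → ∀ r s → Stop r s → b * 𝟙[ isFirst r ] + (b + q ^ ℓ) * 𝟙[ isSecond r ] ≤ B.capital s
  capitalᴮ-at-stop _ _ s (stop-undecided .s) = ≤-trans (≤-reflexive (nothing b (q ^ ℓ))) z≤n
    where
    nothing : ∀ b Q → b * 0 + (b + Q) * 0 ≡ 0
    nothing = solve-∀
  capitalᴮ-at-stop _ _ _ (stop-first x s) = ≤-trans (≤-reflexive (first-term b (q ^ ℓ))) (m≤m+n (1 * b) _)
    where
    first-term : ∀ b Q → b * 1 + (b + Q) * 0 ≡ 1 * b
    first-term = solve-∀
  capitalᴮ-at-stop 1≤L _ _ (stop-second x s _ hit₂) = begin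
    b * 0 + (b + q ^ ℓ) * 1                                     ≡⟨ both-ends b (q ^ ℓ) ⟩
    1 * b + 1 * q ^ ℓ
      ≡⟨ cong₂ (λ m w → 1 * b + 𝟙[ m ] * w) (sym (hit⇒B-matched (x ∷ s) hit₂)) (sym B.weight-top) ⟩
    𝟙[ matchesᴮ 1 (x ∷ s) ] * b + 𝟙[ matchesᴮ ℓ (x ∷ s) ] * B.weight ℓ ≤⟨ B.capital-first+last 1≤L (x ∷ s) ⟩
    B.capital (x ∷ s)                                           ∎
    where
    open ≤-Reasoning
    both-ends : ∀ b Q → b * 0 + (b + Q) * 1 ≡ 1 * b + 1 * Q
    both-ends = solve-∀

  stoppedSumᴬ≤ : ∀ n → stoppedSum A.capital [] n ≤ Gmax * F n + Gmax⁻ * S n + Gmax * U n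
  stoppedSumᴬ≤ n = begin
    stoppedSum A.capital [] n
      ≤⟨ stoppedSum-≤ [] n capitalᴬ-at-stop ⟩
    outcomeSum (λ r → Gmax * 𝟙[ isFirst r ] + Gmax⁻ * 𝟙[ isSecond r ] + Gmax * 𝟙[ isUndecided r ]) [] n
      ≡⟨ ∑-+ _ _ (allWords q n) ⟩
    outcomeSum (λ r → Gmax * 𝟙[ isFirst r ] + Gmax⁻ * 𝟙[ isSecond r ]) [] n
      + outcomeSum (λ r → Gmax * 𝟙[ isUndecided r ]) [] n
      ≡⟨ cong₂ _+_ (∑-linear Gmax Gmax⁻ _ _ (allWords q n)) (∑-* Gmax _ (allWords q n)) ⟩
    Gmax * F n + Gmax⁻ * S n + Gmax * U n ∎
    where open ≤-Reasoning

  stoppedSumᴮ≥ : 1 ≤ L → ∀ n → b * F n + (b + q ^ ℓ) * S n ≤ stoppedSum B.capital [] n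
  stoppedSumᴮ≥ 1≤L n = begin
    b * F n + (b + q ^ ℓ) * S n
      ≡⟨ sym (∑-linear b (b + q ^ ℓ) _ _ (allWords q n)) ⟩
    outcomeSum (λ r → b * 𝟙[ isFirst r ] + (b + q ^ ℓ) * 𝟙[ isSecond r ]) [] n
      ≤⟨ stoppedSum-≥ [] n (capitalᴮ-at-stop 1≤L) ⟩
    stoppedSum B.capital [] n ∎
    where open ≤-Reasoning

  stopping-from-empty : ∀ n → a * stoppedSum B.capital [] n ≤ b * stoppedSum A.capital [] n
  stopping-from-empty n =
    subst₂ _≤_ (vanish (a * stoppedSum B.capital [] n) (q ^ n * b)) (vanish (b * stoppedSum A.capital [] n) (q ^ n * a))
               (optional-stopping n [] refl)
    where
    vanish : ∀ x y → x + y * ∑[ j < ℓ ] 0 ≡ x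
    vanish x y = trans (cong (λ c → x + y * c) (trans (∑<-const ℓ 0) (*-zeroʳ ℓ)))
                       (trans (cong (x +_) (*-zeroʳ y)) (+-identityʳ x))

  a≡q↓ℓ : a ≡ q ↓ ℓ
  a≡q↓ℓ = A.weight-one refl

  undecided-bound : ∀ n → a * n * U n ≤ q ^ n * Gmax
  undecided-bound n = begin
    a * n * U n                          ≤⟨ m≤n+m _ _ ⟩
    q ^ n * A.capital [] + a * n * U n   ≤⟨ undecided-decay n [] refl ⟩
    stoppedSum A.capital [] n            ≤⟨ ∑-mono-≤ (allWords q n) (λ u → A.capital≤maxCapital (stopped [] (vecToList u))) ⟩
    ∑[ u ∈ allWords q n ] Gmax   ≡⟨ ∑-allWords-const q n Gmax ⟩
    q ^ n * Gmax                 ∎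
    where open ≤-Reasoning

  undecided-small : L < q → ∀ M n → M * Gmax ≤ n → M * U n ≤ q ^ n
  undecided-small L<q M n MG≤n = *-cancelʳ-≤ (M * U n) (q ^ n) Gmax {{>-nonZero 0<G}} (begin
    M * U n * Gmax  ≡⟨ *-comm-middle M (U n) Gmax ⟩
    M * Gmax * U n  ≤⟨ *-monoˡ-≤ (U n) MG≤n ⟩
    n * U n         ≤⟨ m≤m*n′ (n * U n) ⟩
    a * (n * U n)   ≡⟨ sym (*-assoc a n (U n)) ⟩
    a * n * U n     ≤⟨ undecided-bound n ⟩
    q ^ n * Gmax    ∎)
    where
    open ≤-Reasoning
    1≤a : 1 ≤ a
    1≤a = subst (1 ≤_) (sym a≡q↓ℓ) (↓-positive L<q)
    0<G : 0 < Gmax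
    0<G = ≤-trans 1≤a (m≤m+n a _)
    m≤m*n′ : ∀ x → x ≤ a * x
    m≤m*n′ x = subst (_≤ a * x) (*-identityˡ x) (*-monoˡ-≤ x 1≤a)
    *-comm-middle : ∀ x y z → x * y * z ≡ x * z * y
    *-comm-middle = solve-∀

  hit₂⇒hit₁ : Distinct w → ∀ h → hits ℓ (test dec₂) h ≡ true → hits ℓ (test dec₁) h ≡ true
  hit₂⇒hit₁ distinct h hit₂ with hits⇒window ℓ (test dec₂) h hit₂
  ... | v , window≡v , t₂v = trans (hits-window ℓ (test dec₁) h v window≡v)
                                   (dec-true (dec₁ v) (orbit-Distinct w v distinct (does⇒ (dec₂ v) t₂v)))

  no-second : Distinct w → ∀ r s → Stop r s → 𝟙[ isSecond r ] ≤ 0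
  no-second _        _ _ (stop-undecided _)             = z≤n
  no-second _        _ _ (stop-first _ _)               = z≤n
  no-second distinct _ _ (stop-second x s no-hit₁ hit₂)
    with () ← trans (sym no-hit₁) (hit₂⇒hit₁ distinct (x ∷ s) hit₂)

  distinct-bias : Distinct w → Bias
  distinct-bias distinct = 0 , 0 , λ n → ≤-reflexive (trans (+-identityʳ (S n)) (S≡0 n))
    where
    S≡0 : ∀ n → S n ≡ 0
    S≡0 n = n≤0⇒n≡0 (begin
      S n                                   ≤⟨ stoppedSum-≥ {g = λ _ → 0} [] n (no-second distinct) ⟩
      stoppedSum (λ _ → 0) [] n             ≡⟨ trans (∑-allWords-const q n 0) (*-zeroʳ (q ^ n)) ⟩
      0                                     ∎)
      where open ≤-Reasoning

module NonDistinct (q L′ : ℕ) (w : Word q (suc (suc L′)))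
                   (dec₁ : Decidable (Distinct {q} {suc (suc L′)})) (dec₂ : Decidable (InOrbit w))
                   (2L′+3≤q : 2 * L′ + 3 ≤ q) (¬distinct : ¬ Distinct w) where

  open DistinctVersusOrbit q (suc L′) w dec₁ dec₂

  L : ℕ
  L = suc L′

  Q : ℕ
  Q = q ^ L * (q ∸ L)

  L≤q : L ≤ q
  L≤q = ≤-trans (m≤m+n (suc L′) (L′ + 2)) (≤-trans (≤-reflexive (split L′)) 2L′+3≤q)
    where
    split : ∀ L′ → suc L′ + (L′ + 2) ≡ 2 * L′ + 3
    split = solve-∀

  a≡q↓L*[q∸L] : a ≡ q ↓ L * (q ∸ L)
  a≡q↓L*[q∸L] = trans a≡q↓ℓ (↓-suc q L)

  b≤q↓L : b ≤ q ↓ L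
  b≤q↓L = begin
    b                                ≡⟨ B.weight-one refl ⟩
    ∏from extensionsᴮ 0 ℓ            ≡⟨ ∏from-extensionsᴮ ℓ ⟩
    q ↓ #distinct (wᵣ ℓ)             ≤⟨ ↓-mono-≤ #wᵣ≤L L≤q ⟩
    q ↓ L                            ∎
    where
    open ≤-Reasoning
    #wᵣ≤L : #distinct (wᵣ ℓ) ≤ L
    #wᵣ≤L = ≤-pred (begin-strict
      #distinct (wᵣ ℓ)                   ≡⟨ cong #distinct (reversedPrefix-all w _) ⟩
      #distinct (reverse (vecToList w))  ≡⟨ #distinct-reverse (vecToList w) ⟩
      #distinct (vecToList w)            <⟨ ¬Distinct⇒#distinct<length w ¬distinct ⟩
      ℓ                                  ∎)

  weightᴬ≤Q : ∀ k → k ≤ L → A.weight k ≤ Q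
  weightᴬ≤Q k k≤L = begin
    q ^ k * ∏from (q ∸_) k (ℓ ∸ k)                 ≡⟨ cong (λ r → q ^ k * ∏from (q ∸_) k r) (+-∸-assoc 1 k≤L) ⟩
    q ^ k * ∏from (q ∸_) k (suc (L ∸ k))           ≤⟨ *-monoʳ-≤ (q ^ k) (∏from-∸ q k (L ∸ k)) ⟩
    q ^ k * (q ^ (L ∸ k) * (q ∸ (k + (L ∸ k))))    ≡⟨ sym (*-assoc (q ^ k) _ _) ⟩
    q ^ k * q ^ (L ∸ k) * (q ∸ (k + (L ∸ k)))      ≡⟨ cong (_* (q ∸ (k + (L ∸ k)))) (sym (^-distribˡ-+-* q k (L ∸ k))) ⟩
    q ^ (k + (L ∸ k)) * (q ∸ (k + (L ∸ k)))        ≡⟨ cong (λ i → q ^ i * (q ∸ i)) (m+[n∸m]≡n k≤L) ⟩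
    Q                                              ∎
    where open ≤-Reasoning

  Gmax⁻≤ : Gmax⁻ ≤ a + L′ * Q
  Gmax⁻≤ = begin
    a + ∑[ j < L′ ] A.weight (suc (suc j))  ≤⟨ +-monoʳ-≤ a (∑<-mono-≤ L′ (λ j j<L′ → weightᴬ≤Q (suc (suc j)) (s≤s j<L′))) ⟩
    a + ∑[ j < L′ ] Q                       ≡⟨ cong (a +_) (∑<-const L′ Q) ⟩
    a + L′ * Q                              ∎
    where open ≤-Reasoning

  costs-separated : b * (2 * (L′ * Q) + q ^ ℓ) + 1 ≤ a * q ^ ℓ
  costs-separated = subst (λ c → b * (2 * (L′ * Q) + q ^ ℓ) + 1 ≤ c * q ^ ℓ) (sym a≡q↓L*[q∸L])
              (cost-gap {b} {q ↓ L} {q ∸ L} {L′} {q ^ L} {q} b≤q↓L (↓-positive L≤q) 1≤q^L (extension-gap L′ q 2L′+3≤q))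
    where
    1≤q^L : 1 ≤ q ^ L
    1≤q^L = subst (_≤ q ^ L) (^-zeroˡ L) (^-monoˡ-≤ L (≤-trans (s≤s z≤n) L≤q))

  stopping-inequality : ∀ n → a * (b * F n + (b + q ^ ℓ) * S n)
                              ≤ b * ((Gmax⁻ + q ^ ℓ) * F n + Gmax⁻ * S n + (Gmax⁻ + q ^ ℓ) * U n)
  stopping-inequality n = begin
    a * (b * F n + (b + q ^ ℓ) * S n)            ≤⟨ *-monoʳ-≤ a (stoppedSumᴮ≥ (s≤s z≤n) n) ⟩
    a * stoppedSum B.capital [] n                ≤⟨ stopping-from-empty n ⟩
    b * stoppedSum A.capital [] n                ≤⟨ *-monoʳ-≤ b (stoppedSumᴬ≤ n) ⟩
    b * (Gmax * F n + Gmax⁻ * S n + Gmax * U n)  ≡⟨ cong (λ G → b * (G * F n + Gmax⁻ * S n + G * U n)) Gmax-split ⟩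
    b * ((Gmax⁻ + q ^ ℓ) * F n + Gmax⁻ * S n + (Gmax⁻ + q ^ ℓ) * U n) ∎
    where open ≤-Reasoning

  bias : Bias
  bias = b * (L′ * Q + q ^ ℓ) , b * (Gmax⁻ + q ^ ℓ) , λ n →
    bias-from-stopping {a} {b} {F n} {S n} {U n} {Gmax⁻} {L′ * Q} {q ^ ℓ} (stopping-inequality n) Gmax⁻≤ costs-separated

nonDistinct-bias : ∀ q L (w : Word q (suc L)) dec₁ dec₂ → 2 * suc L < q + 2 → ¬ Distinct w →
                   DistinctVersusOrbit.Bias q L w dec₁ dec₂
nonDistinct-bias q zero     w _    _    _       ¬distinct = ⊥-elim (¬distinct (Distinct-single w))
nonDistinct-bias q (suc L′) w dec₁ dec₂ 2ℓ<q+2 ¬distinct =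
  NonDistinct.bias q L′ w dec₁ dec₂ (subst (_≤ q) (+-suc-twice L′) (length-bound (suc L′) q 2ℓ<q+2)) ¬distinct
  where
  +-suc-twice : ∀ L′ → 2 * suc L′ + 1 ≡ 2 * L′ + 3
  +-suc-twice = solve-∀

mainTheorem5 : (q ℓ : ℕ) → 1 ≤ ℓ → 2 * ℓ < q + 2
    → (w : Word q ℓ)
    → ¬ (∀ v → InOrbit w v ⇔ Distinct v)
    → (dec₁ : Decidable (Distinct {q} {ℓ}))
    → (dec₂ : Decidable (InOrbit w))
    → ∃[ c ] ∃[ d ] ∃[ N ] (1 ≤ c × (∀ n → N ≤ n →
        d * countOutcome ℓ (test dec₁) (test dec₂) isSecond n + c * q ^ n
          ≤ d * countOutcome ℓ (test dec₁) (test dec₂) isFirst n))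
mainTheorem5 q (suc L) _ 2ℓ<q+2 w _ dec₁ dec₂ =
  eventually-first-ahead (#outcome-total []) (undecided-small L<q) (bias (dec₁ w))
  where
  open DistinctVersusOrbit q L w dec₁ dec₂
  L<q : L < q
  L<q = ≤-trans (≤-trans (m≤m+n (suc L) L) (≤-reflexive (regroup L))) (length-bound L q 2ℓ<q+2)
    where
    regroup : ∀ L → suc L + L ≡ 2 * L + 1
    regroup = solve-∀
  bias : Dec (Distinct w) → Bias
  bias (yes distinct) = distinct-bias distinct
  bias (no ¬distinct) = nonDistinct-bias q L w dec₁ dec₂ 2ℓ<q+2 ¬distinct
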